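{- There exist absolute constants $C\ge 1$ and $p>0$ such that for every graph $G$ and every upper bound $\widetilde\Delta$ on its maximum degree, $\mathtt{GlobalAlg}(G,\widetilde\Delta)$ outputs a matching of $G$ of size at least $|M_{\rm OPT}|/C$ with probability at least $p$, where $M_{\rm OPT}$ is a maximum matching of $G$. (That is, $\mathtt{GlobalAlg}$ computes a constant factor approximation to maximum matching with $\Omega(1)$ probability.)
   Context: For a vertex $v$, $N(v)$ is its set of neighbors in $G=(V,E)$; $G[U]$ is the subgraph induced by $U$. $\mathtt{GlobalAlg}(G,\widetilde\Delta)$: set $\Delta\leftarrow\widetilde\Delta$, $M\leftarrow\emptyset$, $V'\leftarrow V$. While $\Delta\ge 1$: (1) let $H\subseteq V'$ be the set of vertices of degree at least $\Delta/2$ in $G[V']$; (2) create $F$ by including each $v\in V'$ independently with probability $|N(v)\cap H|/(4\Delta)$; (3) compute $\widetilde M=\mathtt{MatchHeavy}(H,F)$ and add it to $M$; (4) set $V'\leftarrow V'\setminus(H\cup F)$, $\Delta\leftarrow\Delta/2$. Return $M$. $\mathtt{MatchHeavy}(H,F)$: (a) every $v\in F$ picks uniformly at random $v_\star\in N(v)\cap H$; (b) independently color each vertex of $H\cup F$ red or blue with probability $1/2$ each; (c) $E_\star=\{(v,v_\star): v\in F\text{ red}, v_\star\in H\text{ blue}\}$; (d) for every blue vertex $w$ incident to an edge of $E_\star$, select one such edge and add it to $\widetilde M$; return $\widetilde M$.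
   Formalization: The upper bound $\widetilde\Delta$ on the maximum degree is taken to be a rational number. -}

module Defs where

open import Data.Bool using (Bool; true; false; _∧_; _∨_; not; if_then_else_; T)
open import Data.Nat using (ℕ; zero; suc; _+_; _*_; _∸_; _^_; _≤_; _≤ᵇ_)
open import Data.Fin using (Fin) renaming (_≟_ to _≟F_)
open import Data.List using (List; []; _∷_; length; map; concatMap; filterᵇ; foldr; _++_; allFin; lookup)
open import Data.List.Relation.Unary.AllPairs using (AllPairs)
open import Data.Product using (_×_; _,_; proj₁; proj₂)
open import Data.Integer using (+_)
open import Data.Rational using (ℚ; _/_; 0ℚ; 1ℚ; ½) renaming (_+_ to _+ℚ_; _*_ to _*ℚ_)
open import Relation.Binary.PropositionalEquality using (_≡_)
open import Relation.Nullary.Decidable using (⌊_⌋)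

record Graph (n : ℕ) : Set where
  field
    adj    : Fin n → Fin n → Bool
    sym    : ∀ u v → adj u v ≡ adj v u
    irrefl : ∀ v → adj v v ≡ false
open Graph public

Edge : ℕ → Set
Edge n = Fin n × Fin n

VSet : ℕ → Set
VSet n = Fin n → Bool

degIn : ∀ {n} → Graph n → VSet n → Fin n → ℕ
degIn {n} G S v = length (filterᵇ (λ u → S u ∧ adj G v u) (allFin n))

deg : ∀ {n} → Graph n → Fin n → ℕ
deg G v = degIn G (λ _ → true) v

allᵇ : ∀ {A : Set} → (A → Bool) → List A → Bool
allᵇ P [] = true
allᵇ P (x ∷ xs) = P x ∧ allᵇ P xs

noDupᵇ : ∀ {n} → List (Fin n) → Bool
noDupᵇ [] = true
noDupᵇ (x ∷ xs) = allᵇ (λ y → not ⌊ x ≟F y ⌋) xs ∧ noDupᵇ xs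

isMatchingᵇ : ∀ {n} → Graph n → List (Edge n) → Bool
isMatchingᵇ G M =
  allᵇ (λ e → adj G (proj₁ e) (proj₂ e)) M ∧
  noDupᵇ (concatMap (λ e → proj₁ e ∷ proj₂ e ∷ []) M)

IsMaximumMatching : ∀ {n} → Graph n → List (Edge n) → Set
IsMaximumMatching G M =
  T (isMatchingᵇ G M) × (∀ M' → T (isMatchingᵇ G M') → length M' ≤ length M)

Dist : Set → Set
Dist A = List (ℚ × A)

return : ∀ {A} → A → Dist A
return x = (1ℚ , x) ∷ []

_>>=_ : ∀ {A B} → Dist A → (A → Dist B) → Dist B
d >>= f = concatMap (λ px → map (λ qy → (proj₁ px *ℚ proj₁ qy , proj₂ qy)) (f (proj₂ px))) d

Pr : ∀ {A} → Dist A → (A → Bool) → ℚ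
Pr d P = foldr (λ px acc → (if P (proj₂ px) then proj₁ px else 0ℚ) +ℚ acc) 0ℚ d

-- Bernoulli with success probability min(1, num/den)  (den = 0 gives 0)
bern : ℕ → ℕ → Dist Bool
bern num zero = return false
bern num (suc d) with num ≤ᵇ suc d
... | true  = (+ num / suc d , true) ∷ (+ (suc d ∸ num) / suc d , false) ∷ []
... | false = return true

coin : Dist Bool
coin = (½ , true) ∷ (½ , false) ∷ []

-- uniform choice from a list (default value if the list is empty)
uniform : ∀ {A} → A → List A → Dist A
uniform def [] = return def
uniform def (x ∷ xs) = map (λ y → (+ 1 / suc (length xs) , y)) (x ∷ xs)

update : ∀ {n} {A : Set} → (Fin n → A) → Fin n → A → Fin n → A
update f v a u = if ⌊ u ≟F v ⌋ then a else f u

forEach : ∀ {n} {A : Set} → List (Fin n) → (Fin n → Dist A) → (Fin n → A) → Dist (Fin n → A)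
forEach [] g f = return f
forEach (v ∷ vs) g f = g v >>= λ a → forEach vs g (update f v a)

-- The degree bound Δ̃ is the nonnegative rational a / b.
-- In round i (i = 0,1,...) the current value is Δ = a / (b * 2^i) = a / D.
--   Δ ≥ 1              ⇔  D ≤ a
--   deg ≥ Δ/2          ⇔  a ≤ deg * (2 * D)
--   |N(v)∩H| / (4Δ)    =  (|N(v)∩H| * D) / (4 * a)

-- Rule for step (d) of MatchHeavy: for a blue vertex w whose E⋆-edges come
-- from the (nonempty, increasingly ordered) list x ∷ xs of red F-vertices,
-- select the position of the chosen one.
Chooser : ℕ → Set
Chooser n = (w : Fin n) → (x : Fin n) → (xs : List (Fin n)) → Fin (suc (length xs))

State : ℕ → Set
State n = VSet n × List (Edge n)

module _ {n : ℕ} (G : Graph n) (a b : ℕ) (ch : Chooser n) where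

  pick : Fin n → List (Fin n) → List (Edge n)
  pick w [] = []
  pick w (x ∷ xs) = (lookup (x ∷ xs) (ch w x xs) , w) ∷ []

  matchHeavy : VSet n → VSet n → Dist (List (Edge n))
  matchHeavy H F =
    forEach (allFin n)
      (λ v → if F v then uniform v (filterᵇ (λ u → H u ∧ adj G v u) (allFin n)) else return v)
      (λ v → v) >>= λ star →
    -- (b) colour H ∪ F: true = red, false = blue
    forEach (allFin n) (λ v → if H v ∨ F v then coin else return false) (λ _ → false) >>= λ red →
    return (concatMap (λ w → pick w (filterᵇ (λ v → F v ∧ red v ∧ H w ∧ not (red w) ∧ ⌊ star v ≟F w ⌋) (allFin n)))
                      (allFin n))

  round : ℕ → State n → Dist (State n)
  round D (V' , M) =
    let H : VSet n
        H v = V' v ∧ (a ≤ᵇ degIn G V' v * (2 * D))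
    in forEach (allFin n)
         (λ v → if V' v then bern (degIn G H v * D) (4 * a) else return false)
         (λ _ → false) >>= λ F →
       matchHeavy H F >>= λ M~ →
       return ((λ v → V' v ∧ not (H v ∨ F v)) , M ++ M~)

  -- while Δ ≥ 1; at most a iterations can happen (b ≥ 1), so fuel a suffices
  loop : ℕ → ℕ → State n → Dist (State n)
  loop zero i s = return s
  loop (suc k) i s =
    if b * 2 ^ i ≤ᵇ a then (round (b * 2 ^ i) s >>= loop k (suc i)) else return s

  globalAlg : Dist (List (Edge n))
  globalAlg = loop a 0 ((λ _ → true) , []) >>= λ s → return (proj₂ s)

-- Track the potential Φ = |M| − c·|V ∖ V'| with c = 1/128. In a round with degree bound Δ, a heavy
-- vertex w receives k proposals (red vertices of F choosing w while w is blue). By pairwise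
-- independence E k = y/4 and E k² ≤ y/4 + y²/8 with y = deg(w)/(4Δ) ∈ [1/8, 1/4], so w is matched
-- with probability at least E[k − k²/2] ≥ 7/512. Only H and F leave V', and E|F| ≤ |H|/4, so Φ does
-- not decrease in expectation. Once Δ < 1 the remaining vertices are independent, hence every edge
-- of a maximum matching M* has a removed endpoint and E|M| ≥ |M*|/128. As |M| ≤ |M*| always,
-- |M*|/128 ≤ |M*|·P[|M| ≥ |M*|/256] + |M*|/256, so that probability is at least 1/256.

module Submission where

open import Defs renaming (sym to adj-sym)
open import Data.Bool using (Bool; true; false; _∧_; _∨_; not; if_then_else_; T)
open import Data.Bool.Properties using (∨-zeroʳ; ∨-conicalˡ; ∧-zeroʳ; ∧-identityʳ; T-∧; T-≡; T-not-≡; T?)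
open import Data.Empty using (⊥; ⊥-elim)
open import Data.Fin using (Fin) renaming (_≟_ to _≟F_)
import Data.Integer as ℤ
import Data.Integer.Properties as ℤ
open import Data.Integer.Solver using () renaming (module +-*-Solver to ℤ-Solver)
open import Data.List using (List; []; _∷_; length; map; filterᵇ; allFin; _++_; concatMap)
open import Data.List.Properties using (length-++; length-map; concatMap-++)
open import Data.List.Membership.Propositional using (_∈_; _∉_)
open import Data.List.Membership.Propositional.Properties
  using (∈-allFin; ∈-filter⁺; ∈-filter⁻; ∈-map⁺; ∈-map⁻; ∈-concatMap⁻; ∈-lookup; ∈-++⁻)
import Data.List.Relation.Binary.Sublist.Propositional as Sublist
import Data.List.Relation.Binary.Sublist.Propositional.Properties as Sublist
open import Data.List.Relation.Unary.All as All using (All; []; _∷_)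
import Data.List.Relation.Unary.All.Properties as All
open import Data.List.Relation.Unary.Any as Any using (here; there)
open import Data.List.Relation.Unary.Unique.Propositional using (Unique; []; _∷_)
import Data.List.Relation.Unary.Unique.Propositional.Properties as Unique
open import Data.List.Relation.Unary.Unique.Propositional.Properties using (allFin⁺)
open import Data.Nat as ℕ using (ℕ; zero; suc; _∸_; _^_; _≤ᵇ_)
import Data.Nat.Properties as ℕ
open import Data.Product as Product using (Σ; _×_; _,_; proj₁; proj₂)
open import Data.Rational using (ℚ; 0ℚ; 1ℚ; ½; _/_; _+_; _*_; -_; _≤_; _<_; toℚᵘ; nonNegative; Positive)
open import Data.Rational.Properties
open import Data.Rational.Solver using (module +-*-Solver)
import Data.Rational.Unnormalised as ℚᵘ
import Data.Rational.Unnormalised.Properties as ℚᵘ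
open import Data.Sum using (_⊎_; inj₁; inj₂; [_,_]′)
open import Function using (_∘_; _⇔_; mk⇔; Equivalence)
open import Relation.Binary.PropositionalEquality
open import Relation.Nullary using (¬_; yes; no)
open import Relation.Nullary.Decidable using (⌊_⌋; toWitness)

private
  variable
    A B X Y : Set
    n : ℕ

-- Rational arithmetic

fromℕ : ℕ → ℚ
fromℕ m = ℤ.+ m / 1

1/suc : ℕ → ℚ
1/suc k = ℤ.+ 1 / suc k

private
  toℚᵘ-/suc : ∀ i k → toℚᵘ (i / suc k) ℚᵘ.≃ ℚᵘ.mkℚᵘ i k
  toℚᵘ-/suc i k = toℚᵘ-fromℚᵘ (ℚᵘ.mkℚᵘ i k)

  ≡-via-toℚᵘ : ∀ {p q r s} → toℚᵘ p ℚᵘ.≃ r → toℚᵘ q ℚᵘ.≃ s → r ℚᵘ.≃ s → p ≡ q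
  ≡-via-toℚᵘ p≃r q≃s r≃s = toℚᵘ-injective (ℚᵘ.≃-trans p≃r (ℚᵘ.≃-trans r≃s (ℚᵘ.≃-sym q≃s)))

  toℚᵘ-fromℕ : ∀ m → toℚᵘ (fromℕ m) ℚᵘ.≃ ℚᵘ.mkℚᵘ (ℤ.+ m) 0
  toℚᵘ-fromℕ m = toℚᵘ-/suc (ℤ.+ m) 0

  toℚᵘ-* : ∀ p q {r s} → toℚᵘ p ℚᵘ.≃ r → toℚᵘ q ℚᵘ.≃ s → toℚᵘ (p * q) ℚᵘ.≃ r ℚᵘ.* s
  toℚᵘ-* p q p≃r q≃s = ℚᵘ.≃-trans (toℚᵘ-homo-* p q) (ℚᵘ.*-cong p≃r q≃s)

/suc≡fromℕ*1/suc : ∀ m k → ℤ.+ m / suc k ≡ fromℕ m * 1/suc k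
/suc≡fromℕ*1/suc m k = ≡-via-toℚᵘ (toℚᵘ-/suc (ℤ.+ m) k)
  (toℚᵘ-* (fromℕ m) (1/suc k) (toℚᵘ-fromℕ m) (toℚᵘ-/suc (ℤ.+ 1) k))
  (ℚᵘ.*≡* (solve 2 (λ x y → x :* (con (ℤ.+ 1) :* y) := (x :* con (ℤ.+ 1)) :* y) refl (ℤ.+ m) (ℤ.+ suc k)))
  where open ℤ-Solver

fromℕ-+ : ∀ m n → fromℕ (m ℕ.+ n) ≡ fromℕ m + fromℕ n
fromℕ-+ m n = ≡-via-toℚᵘ (toℚᵘ-fromℕ (m ℕ.+ n))
  (ℚᵘ.≃-trans (toℚᵘ-homo-+ (fromℕ m) (fromℕ n)) (ℚᵘ.+-cong (toℚᵘ-fromℕ m) (toℚᵘ-fromℕ n)))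
  (ℚᵘ.*≡* (trans (cong (ℤ._* (ℤ.1ℤ ℤ.* ℤ.1ℤ)) (ℤ.pos-+ m n))
    (solve 2 (λ x y → (x :+ y) :* (con (ℤ.+ 1) :* con (ℤ.+ 1))
                   := (x :* con (ℤ.+ 1) :+ y :* con (ℤ.+ 1)) :* con (ℤ.+ 1)) refl (ℤ.+ m) (ℤ.+ n))))
  where open ℤ-Solver

fromℕ-* : ∀ m n → fromℕ (m ℕ.* n) ≡ fromℕ m * fromℕ n
fromℕ-* m n = ≡-via-toℚᵘ (toℚᵘ-fromℕ (m ℕ.* n)) (toℚᵘ-* (fromℕ m) (fromℕ n) (toℚᵘ-fromℕ m) (toℚᵘ-fromℕ n))
  (ℚᵘ.*≡* (trans (cong (ℤ._* (ℤ.1ℤ ℤ.* ℤ.1ℤ)) (ℤ.pos-* m n))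
    (solve 2 (λ x y → (x :* y) :* (con (ℤ.+ 1) :* con (ℤ.+ 1)) := (x :* y) :* con (ℤ.+ 1)) refl (ℤ.+ m) (ℤ.+ n))))
  where open ℤ-Solver

fromℕ-suc*1/suc : ∀ k → fromℕ (suc k) * 1/suc k ≡ 1ℚ
fromℕ-suc*1/suc k = trans (sym (/suc≡fromℕ*1/suc (suc k) k))
  (≡-via-toℚᵘ (toℚᵘ-/suc (ℤ.+ suc k) k) (toℚᵘ-/suc (ℤ.+ 1) 0)
    (ℚᵘ.*≡* (solve 1 (λ x → x :* con (ℤ.+ 1) := con (ℤ.+ 1) :* x) refl (ℤ.+ suc k))))
  where open ℤ-Solver

fromℕ-mono-≤ : ∀ {m n} → m ℕ.≤ n → fromℕ m ≤ fromℕ n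
fromℕ-mono-≤ {m} {n} m≤n = toℚᵘ-cancel-≤
  (ℚᵘ.≤-respˡ-≃ (ℚᵘ.≃-sym (toℚᵘ-fromℕ m)) (ℚᵘ.≤-respʳ-≃ (ℚᵘ.≃-sym (toℚᵘ-fromℕ n))
    (ℚᵘ.*≤* (ℤ.*-monoʳ-≤-nonNeg (ℤ.+ 1) (ℤ.+≤+ m≤n)))))

/suc-nonNeg : ∀ m k → 0ℚ ≤ ℤ.+ m / suc k
/suc-nonNeg m k = nonNegative⁻¹ _ {{normalize-nonNeg m (suc k)}}

fromℕ-nonNeg : ∀ m → 0ℚ ≤ fromℕ m
fromℕ-nonNeg m = /suc-nonNeg m 0

¼ ⅛ : ℚ
¼ = ½ * ½
⅛ = ½ * ¼

*-nonNeg : ∀ {p q} → 0ℚ ≤ p → 0ℚ ≤ q → 0ℚ ≤ p * q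
*-nonNeg {p} {q} 0≤p 0≤q = nonNegative⁻¹ _ {{nonNeg*nonNeg⇒nonNeg p {{nonNegative 0≤p}} q {{nonNegative 0≤q}}}}

+-nonNeg : ∀ {p q} → 0ℚ ≤ p → 0ℚ ≤ q → 0ℚ ≤ p + q
+-nonNeg 0≤p 0≤q = +-mono-≤ 0≤p 0≤q

*-monoˡ-≤ : ∀ {p q} r → 0ℚ ≤ r → p ≤ q → r * p ≤ r * q
*-monoˡ-≤ r 0≤r = *-monoˡ-≤-nonNeg r {{nonNegative 0≤r}}

p≤q⇒0≤q-p : ∀ {p q} → p ≤ q → 0ℚ ≤ q + - p
p≤q⇒0≤q-p {p} {q} p≤q = subst (_≤ q + - p) (+-inverseʳ p) (+-monoˡ-≤ (- p) p≤q)

≤-by-gap : ∀ {p q} r → q ≡ p + r → 0ℚ ≤ r → p ≤ q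
≤-by-gap {p} r refl 0≤r = subst (_≤ p + r) (+-identityʳ p) (+-monoʳ-≤ p 0≤r)

+-cancelʳ-≤ : ∀ p q r → p + r ≤ q + r → p ≤ q
+-cancelʳ-≤ p q r le = subst₂ _≤_ (cancel p) (cancel q) (+-monoˡ-≤ (- r) le)
  where
  open +-*-Solver
  cancel : ∀ x → x + r + - r ≡ x
  cancel x = solve 2 (λ x r → x :+ r :+ :- r := x) refl x r

-- Finite sums, products and indicators

∑ : List X → (X → ℚ) → ℚ
∑ [] h = 0ℚ
∑ (x ∷ xs) h = h x + ∑ xs h

∏ : List X → (X → ℚ) → ℚ
∏ [] h = 1ℚ
∏ (x ∷ xs) h = h x * ∏ xs h

∑-cong : ∀ (xs : List X) {h h′} → (∀ x → h x ≡ h′ x) → ∑ xs h ≡ ∑ xs h′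
∑-cong [] e = refl
∑-cong (x ∷ xs) e = cong₂ _+_ (e x) (∑-cong xs e)

∑-mono-≤ : ∀ (xs : List X) {h h′} → (∀ x → h x ≤ h′ x) → ∑ xs h ≤ ∑ xs h′
∑-mono-≤ [] e = ≤-refl
∑-mono-≤ (x ∷ xs) e = +-mono-≤ (e x) (∑-mono-≤ xs e)

∑-0 : ∀ (xs : List X) → ∑ xs (λ _ → 0ℚ) ≡ 0ℚ
∑-0 [] = refl
∑-0 (x ∷ xs) = trans (+-identityˡ _) (∑-0 xs)

∑-nonNeg : ∀ (xs : List X) {h} → (∀ x → 0ℚ ≤ h x) → 0ℚ ≤ ∑ xs h
∑-nonNeg xs {h} e = subst (_≤ ∑ xs h) (∑-0 xs) (∑-mono-≤ xs e)

∑-+ : ∀ (xs : List X) h h′ → ∑ xs (λ x → h x + h′ x) ≡ ∑ xs h + ∑ xs h′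
∑-+ [] h h′ = refl
∑-+ (x ∷ xs) h h′ = trans (cong ((h x + h′ x) +_) (∑-+ xs h h′))
  (solve 4 (λ a b c d → (a :+ b) :+ (c :+ d) := (a :+ c) :+ (b :+ d)) refl (h x) (h′ x) (∑ xs h) (∑ xs h′))
  where open +-*-Solver

∑-*ˡ : ∀ (xs : List X) c h → ∑ xs (λ x → c * h x) ≡ c * ∑ xs h
∑-*ˡ [] c h = sym (*-zeroʳ c)
∑-*ˡ (x ∷ xs) c h = trans (cong (c * h x +_) (∑-*ˡ xs c h)) (sym (*-distribˡ-+ c (h x) (∑ xs h)))

∑-*ʳ : ∀ (xs : List X) c h → ∑ xs (λ x → h x * c) ≡ ∑ xs h * c
∑-*ʳ xs c h = trans (∑-cong xs (λ x → *-comm (h x) c)) (trans (∑-*ˡ xs c h) (*-comm c (∑ xs h)))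

∑-swap : ∀ (xs : List X) (ys : List Y) (h : X → Y → ℚ) →
  ∑ xs (λ x → ∑ ys (h x)) ≡ ∑ ys (λ y → ∑ xs (λ x → h x y))
∑-swap [] ys h = sym (∑-0 ys)
∑-swap (x ∷ xs) ys h = trans (cong (∑ ys (h x) +_) (∑-swap xs ys h)) (sym (∑-+ ys (h x) _))

∑-*-∑ : ∀ {X : Set} (xs : List X) (h h′ : X → ℚ) → ∑ xs h * ∑ xs h′ ≡ ∑ xs (λ x → ∑ xs (λ y → h x * h′ y))
∑-*-∑ xs h h′ = go xs
  where
  go : ∀ ys → ∑ ys h * ∑ xs h′ ≡ ∑ ys (λ x → ∑ xs (λ y → h x * h′ y))
  go [] = *-zeroˡ (∑ xs h′)
  go (y ∷ ys) = trans (*-distribʳ-+ (∑ xs h′) (h y) (∑ ys h)) (cong₂ _+_ (sym (∑-*ˡ xs (h y) h′)) (go ys))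

∏-cong : ∀ (xs : List X) {h h′} → (∀ x → h x ≡ h′ x) → ∏ xs h ≡ ∏ xs h′
∏-cong [] e = refl
∏-cong (x ∷ xs) e = cong₂ _*_ (e x) (∏-cong xs e)

∏-1 : ∀ (xs : List X) → ∏ xs (λ _ → 1ℚ) ≡ 1ℚ
∏-1 [] = refl
∏-1 (x ∷ xs) = trans (*-identityˡ _) (∏-1 xs)

𝟙 : Bool → ℚ
𝟙 true = 1ℚ
𝟙 false = 0ℚ

𝟙-nonNeg : ∀ b → 0ℚ ≤ 𝟙 b
𝟙-nonNeg true = nonNegative⁻¹ 1ℚ
𝟙-nonNeg false = ≤-refl

𝟙-∧ : ∀ b c → 𝟙 (b ∧ c) ≡ 𝟙 b * 𝟙 c
𝟙-∧ true c = sym (*-identityˡ (𝟙 c))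
𝟙-∧ false c = sym (*-zeroˡ (𝟙 c))

𝟙-idem : ∀ b → 𝟙 b * 𝟙 b ≡ 𝟙 b
𝟙-idem true = refl
𝟙-idem false = refl

length-filter : ∀ (P : X → Bool) xs → fromℕ (length (filterᵇ P xs)) ≡ ∑ xs (𝟙 ∘ P)
length-filter P [] = refl
length-filter P (x ∷ xs) with P x
... | true = trans (fromℕ-+ 1 (length (filterᵇ P xs))) (cong (1ℚ +_) (length-filter P xs))
... | false = trans (length-filter P xs) (sym (+-identityˡ _))

∑-filter : ∀ (P : X → Bool) xs h → ∑ (filterᵇ P xs) h ≡ ∑ xs (λ x → 𝟙 (P x) * h x)
∑-filter P [] h = refl
∑-filter P (x ∷ xs) h with P x
... | true = cong₂ _+_ (sym (*-identityˡ (h x))) (∑-filter P xs h)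
... | false = trans (∑-filter P xs h) (trans (sym (+-identityˡ _)) (cong (_+ _) (sym (*-zeroˡ (h x)))))

∑-1 : ∀ (xs : List X) → ∑ xs (λ _ → 1ℚ) ≡ fromℕ (length xs)
∑-1 [] = refl
∑-1 (x ∷ xs) = trans (cong (1ℚ +_) (∑-1 xs)) (sym (fromℕ-+ 1 (length xs)))

𝟙-guard : ∀ b {x y} → (b ≡ true → x ≡ y) → 𝟙 b * x ≡ 𝟙 b * y
𝟙-guard true x≡y = cong (1ℚ *_) (x≡y refl)
𝟙-guard false {x} {y} _ = trans (*-zeroˡ x) (sym (*-zeroˡ y))

length-concatMap : ∀ (f : X → List Y) xs → fromℕ (length (concatMap f xs)) ≡ ∑ xs (fromℕ ∘ length ∘ f)
length-concatMap f [] = refl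
length-concatMap f (x ∷ xs) = trans (cong fromℕ (length-++ (f x)))
  (trans (fromℕ-+ (length (f x)) _) (cong (fromℕ (length (f x)) +_) (length-concatMap f xs)))

-- Expectations over finite distributions

E : Dist A → (A → ℚ) → ℚ
E [] h = 0ℚ
E ((p , x) ∷ d) h = p * h x + E d h

OnSupport : Dist A → (A → Set) → Set
OnSupport d P = All (P ∘ proj₂) d

NonNegWeights : Dist A → Set
NonNegWeights = All ((0ℚ ≤_) ∘ proj₁)

IsDistribution : Dist A → Set
IsDistribution d = NonNegWeights d × E d (λ _ → 1ℚ) ≡ 1ℚ

Pr≡E𝟙 : ∀ (d : Dist A) P → Pr d P ≡ E d (𝟙 ∘ P)
Pr≡E𝟙 [] P = refl
Pr≡E𝟙 ((p , x) ∷ d) P with P x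
... | true = cong₂ _+_ (sym (*-identityʳ p)) (Pr≡E𝟙 d P)
... | false = cong₂ _+_ (sym (*-zeroʳ p)) (Pr≡E𝟙 d P)

E-cong : ∀ (d : Dist A) {h h′} → (∀ x → h x ≡ h′ x) → E d h ≡ E d h′
E-cong [] e = refl
E-cong ((p , x) ∷ d) e = cong₂ (λ u v → p * u + v) (e x) (E-cong d e)

E-congˢ : ∀ (d : Dist A) {h h′} → OnSupport d (λ x → h x ≡ h′ x) → E d h ≡ E d h′
E-congˢ [] [] = refl
E-congˢ ((p , x) ∷ d) (e ∷ es) = cong₂ (λ u v → p * u + v) e (E-congˢ d es)

E-monoˢ : ∀ {d : Dist A} {h h′} → IsDistribution d → OnSupport d (λ x → h x ≤ h′ x) → E d h ≤ E d h′
E-monoˢ {d = d} {h} {h′} (nn , _) = go d nn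
  where
  go : ∀ d → NonNegWeights d → OnSupport d (λ x → h x ≤ h′ x) → E d h ≤ E d h′
  go [] _ [] = ≤-refl
  go ((p , x) ∷ d) (0≤p ∷ nn) (le ∷ les) = +-mono-≤ (*-monoˡ-≤ p 0≤p le) (go d nn les)

E-+ : ∀ (d : Dist A) h h′ → E d (λ x → h x + h′ x) ≡ E d h + E d h′
E-+ [] h h′ = refl
E-+ ((p , x) ∷ d) h h′ = trans (cong (p * (h x + h′ x) +_) (E-+ d h h′))
  (solve 5 (λ p a b c e → p :* (a :+ b) :+ (c :+ e) := p :* a :+ c :+ (p :* b :+ e)) refl
     p (h x) (h′ x) (E d h) (E d h′))
  where open +-*-Solver

E-*ˡ : ∀ (d : Dist A) c h → E d (λ x → c * h x) ≡ c * E d h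
E-*ˡ [] c h = sym (*-zeroʳ c)
E-*ˡ ((p , x) ∷ d) c h = trans (cong (p * (c * h x) +_) (E-*ˡ d c h))
  (solve 4 (λ p c a e → p :* (c :* a) :+ c :* e := c :* (p :* a :+ e)) refl p c (h x) (E d h))
  where open +-*-Solver

E-*ʳ : ∀ (d : Dist A) c h → E d (λ x → h x * c) ≡ E d h * c
E-*ʳ d c h = trans (E-cong d (λ x → *-comm (h x) c)) (trans (E-*ˡ d c h) (*-comm c (E d h)))

E-neg : ∀ (d : Dist A) h → E d (λ x → - h x) ≡ - E d h
E-neg [] h = refl
E-neg ((p , x) ∷ d) h = trans (cong (p * - h x +_) (E-neg d h))
  (solve 3 (λ p a e → p :* (:- a) :+ (:- e) := :- (p :* a :+ e)) refl p (h x) (E d h))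
  where open +-*-Solver

E-const : ∀ {d : Dist A} → IsDistribution d → ∀ c → E d (λ _ → c) ≡ c
E-const {d = d} (_ , mass) c = begin
  E d (λ _ → c)         ≡⟨ E-cong d (λ _ → sym (*-identityʳ c)) ⟩
  E d (λ _ → c * 1ℚ)    ≡⟨ E-*ˡ d c (λ _ → 1ℚ) ⟩
  c * E d (λ _ → 1ℚ)    ≡⟨ cong (c *_) mass ⟩
  c * 1ℚ                ≡⟨ *-identityʳ c ⟩
  c                     ∎
  where open ≡-Reasoning

E-∑ : ∀ (d : Dist A) (xs : List X) (h : X → A → ℚ) → E d (λ z → ∑ xs (λ x → h x z)) ≡ ∑ xs (λ x → E d (h x))
E-∑ [] xs h = sym (∑-0 xs)
E-∑ ((p , z) ∷ d) xs h = trans (cong₂ _+_ (sym (∑-*ˡ xs p (λ x → h x z))) (E-∑ d xs h))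
  (sym (∑-+ xs (λ x → p * h x z) (λ x → E d (h x))))

E-return : ∀ (x : A) h → E (return x) h ≡ h x
E-return x h = trans (+-identityʳ _) (*-identityˡ _)

E->>= : ∀ (d : Dist A) (f : A → Dist B) h → E (d >>= f) h ≡ E d (λ x → E (f x) h)
E->>= [] f h = refl
E->>= ((p , x) ∷ d) f h = trans (E-++ (scale (f x)) _) (cong₂ _+_ (E-scale (f x)) (E->>= d f h))
  where
  scale : Dist B → Dist B
  scale = map (λ qy → (p * proj₁ qy , proj₂ qy))
  E-scale : ∀ d′ → E (scale d′) h ≡ p * E d′ h
  E-scale [] = sym (*-zeroʳ p)
  E-scale ((q , y) ∷ d′) = trans (cong₂ _+_ (*-assoc p q (h y)) (E-scale d′)) (sym (*-distribˡ-+ p _ _))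
  E-++ : ∀ d₁ d₂ → E (d₁ ++ d₂) h ≡ E d₁ h + E d₂ h
  E-++ [] d₂ = sym (+-identityˡ _)
  E-++ ((q , y) ∷ d₁) d₂ = trans (cong (q * h y +_) (E-++ d₁ d₂)) (sym (+-assoc (q * h y) (E d₁ h) (E d₂ h)))

OnSupport-all : ∀ (d : Dist A) {P} → (∀ x → P x) → OnSupport d P
OnSupport-all [] f = []
OnSupport-all (px ∷ d) f = f (proj₂ px) ∷ OnSupport-all d f

OnSupport-map : ∀ {d : Dist A} {P Q} → OnSupport d P → (∀ {x} → P x → Q x) → OnSupport d Q
OnSupport-map s f = All.map f s

OnSupport->>= : ∀ (d : Dist A) (f : A → Dist B) {P} → OnSupport d (λ x → OnSupport (f x) P) → OnSupport (d >>= f) P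
OnSupport->>= [] f [] = []
OnSupport->>= ((p , x) ∷ d) f (s ∷ ss) = All.++⁺ (All.map⁺ s) (OnSupport->>= d f ss)

return-isDist : ∀ (x : A) → IsDistribution (return x)
return-isDist x = nonNegative⁻¹ 1ℚ ∷ [] , E-return x _

>>=-isDist : ∀ {d : Dist A} {f : A → Dist B} → IsDistribution d → (∀ x → IsDistribution (f x)) → IsDistribution (d >>= f)
>>=-isDist {d = d} {f} (nn , mass) isf = weights d nn , trans (E->>= d f _) (trans (E-cong d (proj₂ ∘ isf)) mass)
  where
  weights : ∀ d → NonNegWeights d → NonNegWeights (d >>= f)
  weights [] [] = []
  weights ((p , x) ∷ d) (0≤p ∷ nn) = All.++⁺ (All.map⁺ (All.map (*-nonNeg 0≤p) (proj₁ (isf x)))) (weights d nn)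

if-preserves : ∀ (P : A → Set) b {x y} → P x → P y → P (if b then x else y)
if-preserves P true px py = px
if-preserves P false px py = py

E-guarded : ∀ b (d : Dist Bool) {q} c → (b ≡ true → E d 𝟙 ≡ q) →
  E (if b then d else return false) (λ x → 𝟙 x * c) ≡ 𝟙 b * (q * c)
E-guarded true d {q} c Ed≡q = trans (E-*ʳ d c 𝟙) (trans (cong (_* c) (Ed≡q refl)) (sym (*-identityˡ (q * c))))
E-guarded false d {q} c _ = trans (E-return false (λ x → 𝟙 x * c)) (trans (*-zeroˡ c) (sym (*-zeroˡ (q * c))))

-- Independent sampling at every vertex

update-≡ : ∀ (f : Fin n → A) u a → update f u a u ≡ a
update-≡ f u a with u ≟F u
... | yes _ = refl
... | no u≢u = ⊥-elim (u≢u refl)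

update-≢ : ∀ (f : Fin n → A) {t u} a → t ≢ u → update f u a t ≡ f t
update-≢ f {t} {u} a t≢u with t ≟F u
... | yes t≡u = ⊥-elim (t≢u t≡u)
... | no _ = refl

δ : Fin n → Fin n → ℚ
δ w y = 𝟙 ⌊ y ≟F w ⌋

δ-≢ : ∀ {v w : Fin n} → v ≢ w → δ w v ≡ 0ℚ
δ-≢ {v = v} {w} v≢w with v ≟F w
... | yes v≡w = ⊥-elim (v≢w v≡w)
... | no _ = refl

δ-refl : ∀ (w : Fin n) → δ w w ≡ 1ℚ
δ-refl w with w ≟F w
... | yes _ = refl
... | no w≢w = ⊥-elim (w≢w refl)

∑-δ-∉ : ∀ (vs : List (Fin n)) {w} (c : Fin n → ℚ) → w ∉ vs → ∑ vs (λ y → δ w y * c y) ≡ 0ℚ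
∑-δ-∉ [] c w∉ = refl
∑-δ-∉ (t ∷ vs) c w∉ = trans (cong₂ _+_ (trans (cong (_* c t) (δ-≢ (w∉ ∘ here ∘ sym))) (*-zeroˡ (c t)))
                                       (∑-δ-∉ vs c (w∉ ∘ there))) (+-identityˡ 0ℚ)

∑-δ : ∀ {vs : List (Fin n)} {w} (c : Fin n → ℚ) → Unique vs → w ∈ vs → ∑ vs (λ y → δ w y * c y) ≡ c w
∑-δ {vs = t ∷ vs} c (t∉ ∷ _) (here refl) =
  trans (cong₂ _+_ (trans (cong (_* c t) (δ-refl t)) (*-identityˡ (c t)))
                   (∑-δ-∉ vs c (λ t∈ → All.lookup t∉ t∈ refl)))
        (+-identityʳ (c t))
∑-δ {vs = t ∷ vs} {w} c (t∉ ∷ u) (there w∈) =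
  trans (cong₂ _+_ (trans (cong (_* c t) (δ-≢ (λ t≡w → All.lookup t∉ w∈ t≡w))) (*-zeroˡ (c t))) (∑-δ c u w∈))
        (+-identityˡ (c w))

∏-update-∉ : ∀ (vs : List (Fin n)) ψ {u} a → u ∉ vs → ∏ vs (update ψ u a) ≡ ∏ vs ψ
∏-update-∉ [] ψ a u∉ = refl
∏-update-∉ (t ∷ vs) ψ a u∉ = cong₂ _*_ (update-≢ ψ a (u∉ ∘ here ∘ sym)) (∏-update-∉ vs ψ a (u∉ ∘ there))

∏-update-∈ : ∀ {vs : List (Fin n)} ψ {u} a → Unique vs → u ∈ vs → ψ u ≡ 1ℚ → ∏ vs (update ψ u a) ≡ a * ∏ vs ψ
∏-update-∈ {vs = t ∷ vs} ψ a (t∉ ∷ _) (here refl) ψt≡1 = begin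
  update ψ t a t * ∏ vs (update ψ t a) ≡⟨ cong₂ _*_ (update-≡ ψ t a) (∏-update-∉ vs ψ a (λ t∈ → All.lookup t∉ t∈ refl)) ⟩
  a * ∏ vs ψ                           ≡⟨ cong (a *_) (sym (trans (cong (_* ∏ vs ψ) ψt≡1) (*-identityˡ _))) ⟩
  a * (ψ t * ∏ vs ψ)                   ∎
  where open ≡-Reasoning
∏-update-∈ {vs = t ∷ vs} ψ {u} a (t∉ ∷ uniq) (there u∈) ψu≡1 =
  trans (cong₂ _*_ (update-≢ ψ a (All.lookup t∉ u∈)) (∏-update-∈ ψ a uniq u∈ ψu≡1))
        (solve 3 (λ x y z → x :* (y :* z) := y :* (x :* z)) refl (ψ t) a (∏ vs ψ))
  where open +-*-Solver

forEach-isDist : ∀ (vs : List (Fin n)) {g : Fin n → Dist A} f → (∀ t → IsDistribution (g t)) →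
  IsDistribution (forEach vs g f)
forEach-isDist [] f isg = return-isDist f
forEach-isDist (v ∷ vs) f isg = >>=-isDist (isg v) (λ a → forEach-isDist vs (update f v a) isg)

forEach-onSupport : ∀ (vs : List (Fin n)) {g : Fin n → Dist A} f (P : Fin n → A → Set) →
  (∀ u → P u (f u)) → (∀ u → OnSupport (g u) (P u)) → OnSupport (forEach vs g f) (λ x → ∀ u → P u (x u))
forEach-onSupport [] f P pf pg = pf ∷ []
forEach-onSupport (v ∷ vs) {g} f P pf pg = OnSupport->>= (g v) _
  (OnSupport-map (pg v) (λ pa → forEach-onSupport vs (update f v _) P (updated pa) pg))
  where
  updated : ∀ {a} → P v a → ∀ u → P u (update f v a u)
  updated pa u with u ≟F v
  ... | yes refl = pa
  ... | no _ = pf u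

forEach-untouched : ∀ (vs : List (Fin n)) {g : Fin n → Dist A} f {u} → u ∉ vs →
  OnSupport (forEach vs g f) (λ x → x u ≡ f u)
forEach-untouched [] f u∉ = refl ∷ []
forEach-untouched (v ∷ vs) {g} f u∉ = OnSupport->>= (g v) _ (OnSupport-all (g v) (λ a →
  OnSupport-map (forEach-untouched vs (update f v a) (u∉ ∘ there))
    (λ e → trans e (update-≢ f a (u∉ ∘ here)))))

E-forEach-∏ : ∀ (vs : List (Fin n)) (g : Fin n → Dist A) f (φ : Fin n → A → ℚ) → Unique vs →
  E (forEach vs g f) (λ x → ∏ vs (λ t → φ t (x t))) ≡ ∏ vs (λ t → E (g t) (φ t))
E-forEach-∏ [] g f φ [] = E-return f (λ _ → 1ℚ)
E-forEach-∏ (v ∷ vs) g f φ (v∉ ∷ uniq) = begin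
  E (forEach (v ∷ vs) g f) (λ x → ∏ (v ∷ vs) (λ t → φ t (x t)))
    ≡⟨ E->>= (g v) _ _ ⟩
  E (g v) (λ a → E (forEach vs g (update f v a)) (λ x → φ v (x v) * ∏ vs (λ t → φ t (x t))))
    ≡⟨ E-cong (g v) fixed ⟩
  E (g v) (λ a → φ v a * K)
    ≡⟨ E-*ʳ (g v) K (φ v) ⟩
  E (g v) (φ v) * K ∎
  where
  open ≡-Reasoning
  K : ℚ
  K = ∏ vs (λ t → E (g t) (φ t))
  fixed : ∀ a → E (forEach vs g (update f v a)) (λ x → φ v (x v) * ∏ vs (λ t → φ t (x t))) ≡ φ v a * K
  fixed a = trans (E-congˢ (forEach vs g (update f v a))
      (OnSupport-map (forEach-untouched vs (update f v a) (λ v∈ → All.lookup v∉ v∈ refl))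
        (λ {x} xv≡ → cong (λ z → φ v z * ∏ vs (λ t → φ t (x t))) (trans xv≡ (update-≡ f v a)))))
    (trans (E-*ˡ (forEach vs g (update f v a)) (φ v a) _) (cong (φ v a *_) (E-forEach-∏ vs g (update f v a) φ uniq)))

Factor : ℕ → Set → Set
Factor n A = Fin n × (A → ℚ)

-- One test function per vertex whose product over all vertices is the product of the factors.
factorFn : List (Factor n A) → Fin n → A → ℚ
factorFn [] t b = 1ℚ
factorFn ((u , α) ∷ fs) = update (factorFn fs) u α

factorFn-∉ : ∀ (fs : List (Factor n A)) {u} → u ∉ map proj₁ fs → ∀ b → factorFn fs u b ≡ 1ℚ
factorFn-∉ [] u∉ b = refl
factorFn-∉ ((v , α) ∷ fs) u∉ b = trans (cong (λ h → h b) (update-≢ (factorFn fs) α (u∉ ∘ here)))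
                                       (factorFn-∉ fs (u∉ ∘ there) b)

∏-factorFn : ∀ (ev : Fin n → (A → ℚ) → ℚ) → (∀ t {α β} → (∀ b → α b ≡ β b) → ev t α ≡ ev t β) →
  (∀ t → ev t (λ _ → 1ℚ) ≡ 1ℚ) → ∀ fs → Unique (map proj₁ fs) →
  ∏ (allFin n) (λ t → ev t (factorFn fs t)) ≡ ∏ fs (λ (u , α) → ev u α)
∏-factorFn {n = n} ev ev-cong ev-1 [] [] = trans (∏-cong (allFin n) ev-1) (∏-1 (allFin n))
∏-factorFn {n = n} ev ev-cong ev-1 ((u , α) ∷ fs) (u∉ ∷ uniq) = begin
  ∏ (allFin n) (λ t → ev t (factorFn ((u , α) ∷ fs) t))
    ≡⟨ ∏-cong (allFin n) evaluate ⟩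
  ∏ (allFin n) (update ψ u (ev u α))
    ≡⟨ ∏-update-∈ ψ (ev u α) (allFin⁺ n) (∈-allFin u)
         (trans (ev-cong u (factorFn-∉ fs (λ u∈ → All.lookup u∉ u∈ refl))) (ev-1 u)) ⟩
  ev u α * ∏ (allFin n) ψ
    ≡⟨ cong (ev u α *_) (∏-factorFn ev ev-cong ev-1 fs uniq) ⟩
  ev u α * ∏ fs (λ (u , α) → ev u α) ∎
  where
  open ≡-Reasoning
  ψ : Fin n → ℚ
  ψ t = ev t (factorFn fs t)
  evaluate : ∀ t → ev t (factorFn ((u , α) ∷ fs) t) ≡ update ψ u (ev u α) t
  evaluate t with t ≟F u
  ... | yes refl = refl
  ... | no _ = refl

E-forEach-factors : ∀ (g : Fin n → Dist A) f (fs : List (Factor n A)) → Unique (map proj₁ fs) →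
  (∀ t → IsDistribution (g t)) →
  E (forEach (allFin n) g f) (λ x → ∏ fs (λ (u , α) → α (x u))) ≡ ∏ fs (λ (u , α) → E (g u) α)
E-forEach-factors {n = n} g f fs uniq isg = begin
  E (forEach (allFin n) g f) (λ x → ∏ fs (λ (u , α) → α (x u)))
    ≡⟨ E-cong (forEach (allFin n) g f) (λ x → sym (∏-factorFn (λ t α → α (x t)) (λ t e → e (x t)) (λ _ → refl) fs uniq)) ⟩
  E (forEach (allFin n) g f) (λ x → ∏ (allFin n) (λ t → factorFn fs t (x t)))
    ≡⟨ E-forEach-∏ (allFin n) g f (factorFn fs) (allFin⁺ n) ⟩
  ∏ (allFin n) (λ t → E (g t) (factorFn fs t))
    ≡⟨ ∏-factorFn (λ t → E (g t)) (λ t → E-cong (g t)) (λ t → E-const (isg t) 1ℚ) fs uniq ⟩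
  ∏ fs (λ (u , α) → E (g u) α) ∎
  where open ≡-Reasoning

-- recip 0 = 0, matching the convention of bern for a zero denominator.
recip : ℕ → ℚ
recip zero = 0ℚ
recip (suc d) = 1/suc d

recip-nonNeg : ∀ m → 0ℚ ≤ recip m
recip-nonNeg zero = ≤-refl
recip-nonNeg (suc d) = /suc-nonNeg 1 d

bern-isDist : ∀ num den → IsDistribution (bern num den)
bern-isDist num zero = return-isDist false
bern-isDist num (suc d) with num ≤ᵇ suc d in num≤ᵇ
... | false = return-isDist true
... | true = /suc-nonNeg num d ∷ /suc-nonNeg (suc d ∸ num) d ∷ [] , (begin
  p * 1ℚ + (q * 1ℚ + 0ℚ)
    ≡⟨ cong₂ _+_ (*-identityʳ p) (trans (+-identityʳ (q * 1ℚ)) (*-identityʳ q)) ⟩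
  p + q
    ≡⟨ cong₂ _+_ (/suc≡fromℕ*1/suc num d) (/suc≡fromℕ*1/suc (suc d ∸ num) d) ⟩
  fromℕ num * 1/suc d + fromℕ (suc d ∸ num) * 1/suc d
    ≡⟨ trans (sym (*-distribʳ-+ (1/suc d) (fromℕ num) (fromℕ (suc d ∸ num)))) (cong (_* 1/suc d) (sym (fromℕ-+ num (suc d ∸ num)))) ⟩
  fromℕ (num ℕ.+ (suc d ∸ num)) * 1/suc d
    ≡⟨ cong (λ m → fromℕ m * 1/suc d) (ℕ.m+[n∸m]≡n (ℕ.≤ᵇ⇒≤ num (suc d) (subst T (sym num≤ᵇ) _))) ⟩
  fromℕ (suc d) * 1/suc d
    ≡⟨ fromℕ-suc*1/suc d ⟩
  1ℚ ∎)
  where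
  open ≡-Reasoning
  p q : ℚ
  p = ℤ.+ num / suc d
  q = ℤ.+ (suc d ∸ num) / suc d

E-bern-𝟙 : ∀ num den → num ℕ.≤ den → E (bern num den) 𝟙 ≡ fromℕ num * recip den
E-bern-𝟙 num zero _ = sym (*-zeroʳ (fromℕ num))
E-bern-𝟙 num (suc d) num≤den with num ≤ᵇ suc d | ℕ.≤⇒≤ᵇ num≤den
... | true | _ = trans (cong₂ _+_ (*-identityʳ p) (trans (+-identityʳ (q * 0ℚ)) (*-zeroʳ q)))
                       (trans (+-identityʳ p) (/suc≡fromℕ*1/suc num d))
  where
  p q : ℚ
  p = ℤ.+ num / suc d
  q = ℤ.+ (suc d ∸ num) / suc d

coin-isDist : IsDistribution coin
coin-isDist = nonNegative⁻¹ ½ ∷ nonNegative⁻¹ ½ ∷ [] , refl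

E-coin : ∀ h → E coin h ≡ ½ * h true + ½ * h false
E-coin h = cong (½ * h true +_) (+-identityʳ _)

E-uniform : ∀ (def x : A) xs h → E (uniform def (x ∷ xs)) h ≡ recip (length (x ∷ xs)) * ∑ (x ∷ xs) h
E-uniform def x xs h = go (x ∷ xs)
  where
  go : ∀ ys → E (map (λ y → (ℤ.+ 1 / suc (length xs) , y)) ys) h ≡ 1/suc (length xs) * ∑ ys h
  go [] = sym (*-zeroʳ (1/suc (length xs)))
  go (y ∷ ys) = trans (cong (1/suc (length xs) * h y +_) (go ys)) (sym (*-distribˡ-+ (1/suc (length xs)) (h y) (∑ ys h)))

uniform-isDist : ∀ (def : A) xs → IsDistribution (uniform def xs)
uniform-isDist def [] = return-isDist def
uniform-isDist def (x ∷ xs) = weights (x ∷ xs) , (begin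
  E (uniform def (x ∷ xs)) (λ _ → 1ℚ)        ≡⟨ E-uniform def x xs _ ⟩
  1/suc (length xs) * ∑ (x ∷ xs) (λ _ → 1ℚ)  ≡⟨ cong (1/suc (length xs) *_) (∑-1 (x ∷ xs)) ⟩
  1/suc (length xs) * fromℕ (suc (length xs)) ≡⟨ *-comm (1/suc (length xs)) _ ⟩
  fromℕ (suc (length xs)) * 1/suc (length xs) ≡⟨ fromℕ-suc*1/suc (length xs) ⟩
  1ℚ ∎)
  where
  open ≡-Reasoning
  weights : ∀ ys → NonNegWeights (map (λ y → (ℤ.+ 1 / suc (length xs) , y)) ys)
  weights [] = []
  weights (y ∷ ys) = /suc-nonNeg 1 (length xs) ∷ weights ys

uniform-onSupport : ∀ {P : A → Set} def xs → P def → All P xs → OnSupport (uniform def xs) P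
uniform-onSupport def [] Pdef _ = Pdef ∷ []
uniform-onSupport def (x ∷ xs) _ Pxs = All.map⁺ Pxs

-- When no u satisfies P, uniform returns its default v, which misses w.
E-uniform-δ : ∀ (P : Fin n → Bool) {v w} → v ≢ w →
  E (uniform v (filterᵇ P (allFin n))) (δ w) ≡ 𝟙 (P w) * recip (length (filterᵇ P (allFin n)))
E-uniform-δ {n = n} P {v} {w} v≢w with filterᵇ P (allFin n) in eq
... | [] = trans (E-return v (δ w)) (trans (δ-≢ v≢w) (sym (*-zeroʳ (𝟙 (P w)))))
... | x ∷ xs = trans (E-uniform v x xs (δ w)) (trans (cong (recip (length (x ∷ xs)) *_) hits) (*-comm (recip (length (x ∷ xs))) (𝟙 (P w))))
  where
  hits : ∑ (x ∷ xs) (δ w) ≡ 𝟙 (P w)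
  hits = begin
    ∑ (x ∷ xs) (δ w)                               ≡⟨ cong (λ l → ∑ l (δ w)) (sym eq) ⟩
    ∑ (filterᵇ P (allFin n)) (δ w)                 ≡⟨ ∑-filter P (allFin n) (δ w) ⟩
    ∑ (allFin n) (λ y → 𝟙 (P y) * δ w y)           ≡⟨ ∑-cong (allFin n) (λ y → *-comm (𝟙 (P y)) (δ w y)) ⟩
    ∑ (allFin n) (λ y → δ w y * 𝟙 (P y))           ≡⟨ ∑-δ (𝟙 ∘ P) (allFin⁺ n) (∈-allFin w) ⟩
    𝟙 (P w) ∎
    where open ≡-Reasoning

fromℕ*recip : ∀ {m} → m ≢ 0 → fromℕ m * recip m ≡ 1ℚ
fromℕ*recip {zero} m≢0 = ⊥-elim (m≢0 refl)
fromℕ*recip {suc k} _ = fromℕ-suc*1/suc k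

fromℕ*-recip-cancel : ∀ m D β → (T β → m ≢ 0) → fromℕ (m ℕ.* D) * (𝟙 β * recip m) ≡ fromℕ D * 𝟙 β
fromℕ*-recip-cancel m D false _ =
  trans (cong (fromℕ (m ℕ.* D) *_) (*-zeroˡ (recip m))) (trans (*-zeroʳ (fromℕ (m ℕ.* D))) (sym (*-zeroʳ (fromℕ D))))
fromℕ*-recip-cancel m D true m≢0 = begin
  fromℕ (m ℕ.* D) * (1ℚ * recip m)   ≡⟨ cong₂ _*_ (fromℕ-* m D) (*-identityˡ (recip m)) ⟩
  fromℕ m * fromℕ D * recip m        ≡⟨ solve 3 (λ x y z → x :* y :* z := y :* (x :* z)) refl (fromℕ m) (fromℕ D) (recip m) ⟩
  fromℕ D * (fromℕ m * recip m)      ≡⟨ cong (fromℕ D *_) (fromℕ*recip (m≢0 _)) ⟩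
  fromℕ D * 1ℚ                       ∎
  where
  open ≡-Reasoning
  open +-*-Solver

-- One round of GlobalAlg

-- Δ = a / D bounds all degrees in G[X]
DegreeBound : ∀ {n} → Graph n → ℕ → VSet n → ℕ → Set
DegreeBound G a X D = ∀ v → T (X v) → degIn G X v ℕ.* D ℕ.≤ a

degIn-mono : ∀ {n} (G : Graph n) {S S′ : VSet n} v → (∀ u → T (S u) → T (S′ u)) → degIn G S v ℕ.≤ degIn G S′ v
degIn-mono {n} G {S} {S′} v S⊆S′ = Sublist.length-mono-≤ (Sublist.filter⁺ (T? ∘ (λ u → S u ∧ adj G v u)) (T? ∘ (λ u → S′ u ∧ adj G v u))
  (λ { refl t → Equivalence.from T-∧ (Product.map₁ (S⊆S′ _) (Equivalence.to T-∧ t)) }) (Sublist.⊆-refl {x = allFin n}))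

κ : ℚ
κ = ℤ.+ 7 / 512

-- A heavy vertex receiving k proposals has E k = y/4 and E k² ≤ y/4 + y²/8, where y ∈ [1/8, 1/4];
-- this bounds E[k - k²/2] from below.
second-moment : ∀ y → 0ℚ ≤ y → ¼ ≤ y + y → y ≤ ¼ → κ ≤ y * ¼ + - (½ * (y * ¼ + y * y * ⅛))
second-moment y 0≤y lo hi = ≤-by-gap gap
  (solve 1 (λ y → y :* con ¼ :+ :- (con ½ :* (y :* con ¼ :+ y :* y :* con ⅛))
               := con κ :+ (((y :+ y) :+ :- con ¼) :* con (ℤ.+ 7 / 128) :+ y :* (con ¼ :+ :- y) :* (con ¼ :* con ¼))) refl y)
  (+-nonNeg (*-nonNeg (p≤q⇒0≤q-p lo) (/suc-nonNeg 7 127))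
            (*-nonNeg (*-nonNeg 0≤y (p≤q⇒0≤q-p hi)) (nonNegative⁻¹ (¼ * ¼))))
  where
  open +-*-Solver
  gap : ℚ
  gap = ((y + y) + - ¼) * (ℤ.+ 7 / 128) + y * (¼ + - y) * (¼ * ¼)

module Round {n : ℕ} (G : Graph n) (a b : ℕ) (ch : Chooser n) (V' : VSet n) (D : ℕ) where

  H : VSet n
  H v = V' v ∧ (a ≤ᵇ degIn G V' v ℕ.* (2 ℕ.* D))

  sampleF : Fin n → Dist Bool
  sampleF v = if V' v then bern (degIn G H v ℕ.* D) (4 ℕ.* a) else return false

  heavyNbrs : Fin n → List (Fin n)
  heavyNbrs v = filterᵇ (λ u → H u ∧ adj G v u) (allFin n)

  sampleStar : VSet n → Fin n → Dist (Fin n)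
  sampleStar F v = if F v then uniform v (heavyNbrs v) else return v

  sampleRed : VSet n → Fin n → Dist Bool
  sampleRed F v = if H v ∨ F v then coin else return false

  distF : Dist (VSet n)
  distF = forEach (allFin n) sampleF (λ _ → false)

  distStar : VSet n → Dist (Fin n → Fin n)
  distStar F = forEach (allFin n) (sampleStar F) (λ v → v)

  distRed : VSet n → Dist (VSet n)
  distRed F = forEach (allFin n) (sampleRed F) (λ _ → false)

  Outcome : Set
  Outcome = VSet n × (Fin n → Fin n) × VSet n

  sample : Dist Outcome
  sample = distF >>= λ F → distStar F >>= λ st → distRed F >>= λ red → return (F , st , red)

  proposes : Outcome → Fin n → Fin n → Bool
  proposes (F , st , red) v w = F v ∧ red v ∧ H w ∧ not (red w) ∧ ⌊ st v ≟F w ⌋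

  matched : Outcome → List (Edge n)
  matched o = concatMap (λ w → pick G a b ch w (filterᵇ (λ v → proposes o v w) (allFin n))) (allFin n)

  remaining : VSet n → VSet n
  remaining F v = V' v ∧ not (H v ∨ F v)

  E-sample : ∀ k → E sample k ≡ E distF (λ F → E (distStar F) (λ st → E (distRed F) (λ red → k (F , st , red))))
  E-sample k =
    trans (E->>= distF _ k) (E-cong distF λ F →
    trans (E->>= (distStar F) (λ st → distRed F >>= λ red → return (F , st , red)) k) (E-cong (distStar F) λ st →
    trans (E->>= (distRed F) (λ red → return (F , st , red)) k) (E-cong (distRed F) λ red →
    E-return (F , st , red) k)))

  E-round : ∀ M h → E (round G a b ch D (V' , M)) h ≡ E sample (λ o → h (remaining (proj₁ o) , M ++ matched o))
  E-round M h =
    trans (E->>= distF _ h) (trans (E-cong distF (λ F →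
      trans (E->>= (matchHeavy G a b ch H F) (λ M~ → return (remaining F , M ++ M~)) h)
      (trans (E->>= (distStar F) (λ st → distRed F >>= λ red → return (matched (F , st , red))) (λ M~ → E (return (remaining F , M ++ M~)) h))
        (E-cong (distStar F) λ st →
      trans (E->>= (distRed F) (λ red → return (matched (F , st , red))) (λ M~ → E (return (remaining F , M ++ M~)) h)) (E-cong (distRed F) λ red →
      trans (E-return (matched (F , st , red)) (λ M~ → E (return (remaining F , M ++ M~)) h)) (E-return _ h))))))
    (sym (E-sample _)))

  sampleF-isDist : ∀ v → IsDistribution (sampleF v)
  sampleF-isDist v = if-preserves IsDistribution (V' v) (bern-isDist (degIn G H v ℕ.* D) (4 ℕ.* a)) (return-isDist false)

  sampleStar-isDist : ∀ F v → IsDistribution (sampleStar F v)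
  sampleStar-isDist F v = if-preserves IsDistribution (F v) (uniform-isDist v (heavyNbrs v)) (return-isDist v)

  sampleRed-isDist : ∀ F v → IsDistribution (sampleRed F v)
  sampleRed-isDist F v = if-preserves IsDistribution (H v ∨ F v) coin-isDist (return-isDist false)

  sample-isDist : IsDistribution sample
  sample-isDist =
    >>=-isDist (forEach-isDist (allFin n) _ sampleF-isDist) λ F →
    >>=-isDist (forEach-isDist (allFin n) _ (sampleStar-isDist F)) λ st →
    >>=-isDist (forEach-isDist (allFin n) _ (sampleRed-isDist F)) λ red →
    return-isDist (F , st , red)

  p : ℚ
  p = fromℕ D * recip (4 ℕ.* a)

  -- P[v⋆ = w | v ∈ F]
  chooses : Fin n → Fin n → ℚ
  chooses v w = 𝟙 (H w ∧ adj G v w) * recip (length (heavyNbrs v))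

  link : Fin n → Fin n → ℚ
  link v w = 𝟙 (V' v) * 𝟙 (H w ∧ adj G v w)

  𝟙-proposes : ∀ F st red v w → H w ≡ true →
    𝟙 (proposes (F , st , red) v w) ≡ (𝟙 (F v) * δ w (st v)) * (𝟙 (red v) * 𝟙 (not (red w)))
  𝟙-proposes F st red v w Hw rewrite Hw =
    trans (𝟙-∧ (F v) (red v ∧ not (red w) ∧ ⌊ st v ≟F w ⌋))
      (trans (cong (𝟙 (F v) *_) (trans (𝟙-∧ (red v) (not (red w) ∧ ⌊ st v ≟F w ⌋))
                                       (cong (𝟙 (red v) *_) (𝟙-∧ (not (red w)) ⌊ st v ≟F w ⌋))))
      (solve 4 (λ f r q s → f :* (r :* (q :* s)) := (f :* s) :* (r :* q)) refl (𝟙 (F v)) (𝟙 (red v)) (𝟙 (not (red w))) (δ w (st v))))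
    where open +-*-Solver

  E-red-blue : ∀ F {w} → H w ≡ true → E (sampleRed F w) (𝟙 ∘ not) ≡ ½
  E-red-blue F {w} Hw rewrite Hw = trans (E-coin (𝟙 ∘ not)) (trans (cong₂ _+_ (*-zeroʳ ½) (*-identityʳ ½)) (+-identityˡ ½))

  E-red-F : ∀ F v → 𝟙 (F v) * E (sampleRed F v) 𝟙 ≡ 𝟙 (F v) * ½
  E-red-F F v = 𝟙-guard (F v) λ Fv → begin
    E (sampleRed F v) 𝟙                    ≡⟨ cong (λ b → E (if H v ∨ b then coin else return false) 𝟙) Fv ⟩
    E (if H v ∨ true then coin else _) 𝟙   ≡⟨ cong (λ b → E (if b then coin else return false) 𝟙) (∨-zeroʳ (H v)) ⟩
    E coin 𝟙                               ≡⟨ trans (E-coin 𝟙) (trans (cong₂ _+_ (*-identityʳ ½) (*-zeroʳ ½)) (+-identityʳ ½)) ⟩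
    ½ ∎
    where open ≡-Reasoning

  E-star-F : ∀ F {v w} → v ≢ w → 𝟙 (F v) * E (sampleStar F v) (δ w) ≡ 𝟙 (F v) * chooses v w
  E-star-F F {v} {w} v≢w = 𝟙-guard (F v) λ Fv →
    trans (cong (λ b → E (if b then uniform v (heavyNbrs v) else return v) (δ w)) Fv)
          (E-uniform-δ (λ u → H u ∧ adj G v u) v≢w)

  E-red-single : ∀ F st {v w} → v ≢ w → H w ≡ true →
    E (distRed F) (λ red → 𝟙 (proposes (F , st , red) v w)) ≡ 𝟙 (F v) * δ w (st v) * ¼
  E-red-single F st {v} {w} v≢w Hw = begin
    E (distRed F) (λ red → 𝟙 (proposes (F , st , red) v w))
      ≡⟨ E-cong (distRed F) (λ red → trans (𝟙-proposes F st red v w Hw)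
           (cong (λ z → Fδ * (𝟙 (red v) * z)) (sym (*-identityʳ (𝟙 (not (red w))))))) ⟩
    E (distRed F) (λ red → Fδ * (𝟙 (red v) * (𝟙 (not (red w)) * 1ℚ)))
      ≡⟨ E-*ˡ (distRed F) Fδ _ ⟩
    Fδ * E (distRed F) (λ red → 𝟙 (red v) * (𝟙 (not (red w)) * 1ℚ))
      ≡⟨ cong (Fδ *_) (E-forEach-factors (sampleRed F) _ ((v , 𝟙) ∷ (w , 𝟙 ∘ not) ∷ [])
                        ((v≢w ∷ []) ∷ [] ∷ []) (sampleRed-isDist F)) ⟩
    Fδ * (Ev * (E (sampleRed F w) (𝟙 ∘ not) * 1ℚ))
      ≡⟨ cong (λ z → Fδ * (Ev * (z * 1ℚ))) (E-red-blue F Hw) ⟩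
    Fδ * (Ev * (½ * 1ℚ))
      ≡⟨ solve 4 (λ f d e h → (f :* d) :* (e :* (h :* con 1ℚ)) := d :* ((f :* e) :* h)) refl (𝟙 (F v)) (δ w (st v)) Ev ½ ⟩
    δ w (st v) * ((𝟙 (F v) * Ev) * ½)
      ≡⟨ cong (λ z → δ w (st v) * (z * ½)) (E-red-F F v) ⟩
    δ w (st v) * ((𝟙 (F v) * ½) * ½)
      ≡⟨ solve 3 (λ f d h → d :* ((f :* h) :* h) := f :* d :* (h :* h)) refl (𝟙 (F v)) (δ w (st v)) ½ ⟩
    𝟙 (F v) * δ w (st v) * ¼ ∎
    where
    open ≡-Reasoning
    open +-*-Solver
    Fδ Ev : ℚ
    Fδ = 𝟙 (F v) * δ w (st v)
    Ev = E (sampleRed F v) 𝟙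

  -- w must be blue for both proposals; the two copies of that event coincide.
  𝟙-proposes-pair : ∀ F st red u v w → H w ≡ true →
    𝟙 (proposes (F , st , red) u w) * 𝟙 (proposes (F , st , red) v w)
      ≡ (𝟙 (F u) * δ w (st u)) * (𝟙 (F v) * δ w (st v)) * (𝟙 (red u) * (𝟙 (red v) * (𝟙 (not (red w)) * 1ℚ)))
  𝟙-proposes-pair F st red u v w Hw = begin
    𝟙 (proposes (F , st , red) u w) * 𝟙 (proposes (F , st , red) v w)
      ≡⟨ cong₂ _*_ (𝟙-proposes F st red u w Hw) (𝟙-proposes F st red v w Hw) ⟩
    (fu * su) * (ru * bw) * ((fv * sv) * (rv * bw))
      ≡⟨ solve 7 (λ fu su fv sv ru rv b → (fu :* su) :* (ru :* b) :* ((fv :* sv) :* (rv :* b))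
                   := (fu :* su :* (fv :* sv)) :* (ru :* (rv :* ((b :* b) :* con 1ℚ)))) refl fu su fv sv ru rv bw ⟩
    (fu * su) * (fv * sv) * (ru * (rv * ((bw * bw) * 1ℚ)))
      ≡⟨ cong (λ z → (fu * su) * (fv * sv) * (ru * (rv * (z * 1ℚ)))) (𝟙-idem (not (red w))) ⟩
    (fu * su) * (fv * sv) * (ru * (rv * (bw * 1ℚ))) ∎
    where
    open ≡-Reasoning
    open +-*-Solver
    fu fv su sv ru rv bw : ℚ
    fu = 𝟙 (F u)
    fv = 𝟙 (F v)
    su = δ w (st u)
    sv = δ w (st v)
    ru = 𝟙 (red u)
    rv = 𝟙 (red v)
    bw = 𝟙 (not (red w))

  E-red-pair : ∀ F st {u v w} → u ≢ v → u ≢ w → v ≢ w → H w ≡ true →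
    E (distRed F) (λ red → 𝟙 (proposes (F , st , red) u w) * 𝟙 (proposes (F , st , red) v w))
      ≡ (𝟙 (F u) * δ w (st u)) * (𝟙 (F v) * δ w (st v)) * ⅛
  E-red-pair F st {u} {v} {w} u≢v u≢w v≢w Hw = begin
    E (distRed F) (λ red → 𝟙 (proposes (F , st , red) u w) * 𝟙 (proposes (F , st , red) v w))
      ≡⟨ E-cong (distRed F) (λ red → 𝟙-proposes-pair F st red u v w Hw) ⟩
    E (distRed F) (λ red → Fδ² * (𝟙 (red u) * (𝟙 (red v) * (𝟙 (not (red w)) * 1ℚ))))
      ≡⟨ E-*ˡ (distRed F) Fδ² _ ⟩
    Fδ² * E (distRed F) (λ red → 𝟙 (red u) * (𝟙 (red v) * (𝟙 (not (red w)) * 1ℚ)))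
      ≡⟨ cong (Fδ² *_) (E-forEach-factors (sampleRed F) _ ((u , 𝟙) ∷ (v , 𝟙) ∷ (w , 𝟙 ∘ not) ∷ [])
                        ((u≢v ∷ u≢w ∷ []) ∷ (v≢w ∷ []) ∷ [] ∷ []) (sampleRed-isDist F)) ⟩
    Fδ² * (Eu * (Ev * (E (sampleRed F w) (𝟙 ∘ not) * 1ℚ)))
      ≡⟨ cong (λ z → Fδ² * (Eu * (Ev * (z * 1ℚ)))) (E-red-blue F Hw) ⟩
    Fδ² * (Eu * (Ev * (½ * 1ℚ)))
      ≡⟨ solve 7 (λ fu su fv sv eu ev h → (fu :* su :* (fv :* sv)) :* (eu :* (ev :* (h :* con 1ℚ)))
                   := su :* sv :* ((fu :* eu) :* ((fv :* ev) :* h))) refl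
           (𝟙 (F u)) (δ w (st u)) (𝟙 (F v)) (δ w (st v)) Eu Ev ½ ⟩
    δ w (st u) * δ w (st v) * ((𝟙 (F u) * Eu) * ((𝟙 (F v) * Ev) * ½))
      ≡⟨ cong₂ (λ y z → δ w (st u) * δ w (st v) * (y * (z * ½))) (E-red-F F u) (E-red-F F v) ⟩
    δ w (st u) * δ w (st v) * ((𝟙 (F u) * ½) * ((𝟙 (F v) * ½) * ½))
      ≡⟨ solve 5 (λ fu su fv sv h → su :* sv :* ((fu :* h) :* ((fv :* h) :* h)) := fu :* su :* (fv :* sv) :* (h :* (h :* h))) refl
           (𝟙 (F u)) (δ w (st u)) (𝟙 (F v)) (δ w (st v)) ½ ⟩
    (𝟙 (F u) * δ w (st u)) * (𝟙 (F v) * δ w (st v)) * ⅛ ∎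
    where
    open ≡-Reasoning
    open +-*-Solver
    Fδ² Eu Ev : ℚ
    Fδ² = (𝟙 (F u) * δ w (st u)) * (𝟙 (F v) * δ w (st v))
    Eu = E (sampleRed F u) 𝟙
    Ev = E (sampleRed F v) 𝟙

  E-star-single : ∀ F {v w} → v ≢ w →
    E (distStar F) (λ st → 𝟙 (F v) * δ w (st v) * ¼) ≡ 𝟙 (F v) * chooses v w * ¼
  E-star-single F {v} {w} v≢w = begin
    E (distStar F) (λ st → 𝟙 (F v) * δ w (st v) * ¼)
      ≡⟨ E-cong (distStar F) (λ st → solve 3 (λ f d q → f :* d :* q := (f :* q) :* (d :* con 1ℚ)) refl (𝟙 (F v)) (δ w (st v)) ¼) ⟩
    E (distStar F) (λ st → (𝟙 (F v) * ¼) * (δ w (st v) * 1ℚ))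
      ≡⟨ E-*ˡ (distStar F) (𝟙 (F v) * ¼) _ ⟩
    (𝟙 (F v) * ¼) * E (distStar F) (λ st → δ w (st v) * 1ℚ)
      ≡⟨ cong ((𝟙 (F v) * ¼) *_) (E-forEach-factors (sampleStar F) _ ((v , δ w) ∷ []) ([] ∷ []) (sampleStar-isDist F)) ⟩
    (𝟙 (F v) * ¼) * (E (sampleStar F v) (δ w) * 1ℚ)
      ≡⟨ solve 3 (λ f q e → (f :* q) :* (e :* con 1ℚ) := f :* e :* q) refl (𝟙 (F v)) ¼ (E (sampleStar F v) (δ w)) ⟩
    𝟙 (F v) * E (sampleStar F v) (δ w) * ¼
      ≡⟨ cong (_* ¼) (E-star-F F v≢w) ⟩
    𝟙 (F v) * chooses v w * ¼ ∎
    where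
    open ≡-Reasoning
    open +-*-Solver

  E-star-pair : ∀ F {u v w} → u ≢ v → u ≢ w → v ≢ w →
    E (distStar F) (λ st → (𝟙 (F u) * δ w (st u)) * (𝟙 (F v) * δ w (st v)) * ⅛)
      ≡ (𝟙 (F u) * chooses u w) * (𝟙 (F v) * chooses v w) * ⅛
  E-star-pair F {u} {v} {w} u≢v u≢w v≢w = begin
    E (distStar F) (λ st → (𝟙 (F u) * δ w (st u)) * (𝟙 (F v) * δ w (st v)) * ⅛)
      ≡⟨ E-cong (distStar F) (λ st → solve 5 (λ fu su fv sv e → (fu :* su) :* (fv :* sv) :* e := (fu :* fv :* e) :* (su :* (sv :* con 1ℚ))) refl
             (𝟙 (F u)) (δ w (st u)) (𝟙 (F v)) (δ w (st v)) ⅛) ⟩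
    E (distStar F) (λ st → C * (δ w (st u) * (δ w (st v) * 1ℚ)))
      ≡⟨ E-*ˡ (distStar F) C _ ⟩
    C * E (distStar F) (λ st → δ w (st u) * (δ w (st v) * 1ℚ))
      ≡⟨ cong (C *_) (E-forEach-factors (sampleStar F) _ ((u , δ w) ∷ (v , δ w) ∷ []) ((u≢v ∷ []) ∷ [] ∷ []) (sampleStar-isDist F)) ⟩
    C * (Su * (Sv * 1ℚ))
      ≡⟨ solve 5 (λ fu fv e su sv → (fu :* fv :* e) :* (su :* (sv :* con 1ℚ)) := (fu :* su) :* (fv :* sv) :* e) refl
           (𝟙 (F u)) (𝟙 (F v)) ⅛ Su Sv ⟩
    (𝟙 (F u) * Su) * (𝟙 (F v) * Sv) * ⅛
      ≡⟨ cong₂ (λ y z → y * z * ⅛) (E-star-F F u≢w) (E-star-F F v≢w) ⟩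
    (𝟙 (F u) * chooses u w) * (𝟙 (F v) * chooses v w) * ⅛ ∎
    where
    open ≡-Reasoning
    open +-*-Solver
    C Su Sv : ℚ
    C = 𝟙 (F u) * 𝟙 (F v) * ⅛
    Su = E (sampleStar F u) (δ w)
    Sv = E (sampleStar F v) (δ w)

  proposes-self : ∀ o w → proposes o w w ≡ false
  proposes-self (F , st , red) w with F w | red w
  ... | false | _ = refl
  ... | true | false = refl
  ... | true | true = ∧-zeroʳ (H w)

  proposes-light : ∀ o v {w} → H w ≡ false → proposes o v w ≡ false
  proposes-light (F , st , red) v Hw with F v | red v
  ... | false | _ = refl
  ... | true | false = refl
  ... | true | true rewrite Hw = refl

  link-self : ∀ w → link w w ≡ 0ℚ
  link-self w rewrite irrefl G w | ∧-zeroʳ (H w) = *-zeroʳ (𝟙 (V' w))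

  link-nonNeg : ∀ v w → 0ℚ ≤ link v w
  link-nonNeg v w = *-nonNeg (𝟙-nonNeg (V' v)) (𝟙-nonNeg (H w ∧ adj G v w))

  linkDeg : Fin n → ℚ
  linkDeg w = ∑ (allFin n) (λ v → link v w)

  linkDeg-nonNeg : ∀ w → 0ℚ ≤ linkDeg w
  linkDeg-nonNeg w = ∑-nonNeg (allFin n) (λ v → link-nonNeg v w)

  linkDeg-heavy : ∀ {w} → H w ≡ true → linkDeg w ≡ fromℕ (degIn G V' w)
  linkDeg-heavy {w} Hw = trans (∑-cong (allFin n) (λ v → begin
      𝟙 (V' v) * 𝟙 (H w ∧ adj G v w)  ≡⟨ cong (λ z → 𝟙 (V' v) * 𝟙 (z ∧ adj G v w)) Hw ⟩
      𝟙 (V' v) * 𝟙 (adj G v w)        ≡⟨ cong (λ z → 𝟙 (V' v) * 𝟙 z) (adj-sym G v w) ⟩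
      𝟙 (V' v) * 𝟙 (adj G w v)        ≡⟨ sym (𝟙-∧ (V' v) (adj G w v)) ⟩
      𝟙 (V' v ∧ adj G w v)            ∎))
    (sym (length-filter (λ v → V' v ∧ adj G w v) (allFin n)))
    where open ≡-Reasoning

  linkDeg-light : ∀ {w} → H w ≡ false → linkDeg w ≡ 0ℚ
  linkDeg-light {w} Hw = trans (∑-cong (allFin n) (λ v → trans (cong (λ z → 𝟙 (V' v) * 𝟙 (z ∧ adj G v w)) Hw) (*-zeroʳ (𝟙 (V' v)))))
                               (∑-0 (allFin n))

  proposals : Outcome → Fin n → ℚ
  proposals o w = ∑ (allFin n) (λ v → 𝟙 (proposes o v w))

  -- Bonferroni: w is matched iff it gets a proposal, and 𝟙[k ≥ 1] ≥ k - k²/2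
  bonferroni : Outcome → Fin n → ℚ
  bonferroni o w = proposals o w + - (½ * (proposals o w * proposals o w))

  pick-bonferroni : ∀ w (L : List (Fin n)) →
    fromℕ (length L) + - (½ * (fromℕ (length L) * fromℕ (length L))) ≤ fromℕ (length (pick G a b ch w L))
  pick-bonferroni w [] = ≤-refl
  pick-bonferroni w (x ∷ xs) = ≤-by-gap (½ * (m * m + 1ℚ))
    (trans (solve 1 (λ m → con 1ℚ := (con 1ℚ :+ m) :+ :- (con ½ :* ((con 1ℚ :+ m) :* (con 1ℚ :+ m))) :+ con ½ :* (m :* m :+ con 1ℚ)) refl m)
           (cong (λ z → z + - (½ * (z * z)) + ½ * (m * m + 1ℚ)) (sym (fromℕ-+ 1 (length xs)))))
    (*-nonNeg (nonNegative⁻¹ ½) (+-nonNeg (*-nonNeg (fromℕ-nonNeg (length xs)) (fromℕ-nonNeg (length xs))) (nonNegative⁻¹ 1ℚ)))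
    where
    open +-*-Solver
    m : ℚ
    m = fromℕ (length xs)

  matched-bonferroni : ∀ o → ∑ (allFin n) (bonferroni o) ≤ fromℕ (length (matched o))
  matched-bonferroni o = subst (∑ (allFin n) (bonferroni o) ≤_) (sym (length-concatMap _ (allFin n)))
    (∑-mono-≤ (allFin n) λ w → subst (λ k → k + - (½ * (k * k)) ≤ fromℕ (length (pick G a b ch w (L w))))
      (length-filter (λ v → proposes o v w) (allFin n)) (pick-bonferroni w (L w)))
    where
    L : Fin n → List (Fin n)
    L w = filterᵇ (λ v → proposes o v w) (allFin n)

  module WithDegreeBound (bound : DegreeBound G a V' D) (1≤a : 1 ℕ.≤ a) where

    sampleF-bound : ∀ v → T (V' v) → degIn G H v ℕ.* D ℕ.≤ 4 ℕ.* a
    sampleF-bound v Vv = ℕ.≤-trans (ℕ.*-monoˡ-≤ D (degIn-mono G v (λ u → proj₁ ∘ Equivalence.to T-∧)))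
                                   (ℕ.≤-trans (bound v Vv) (ℕ.m≤n*m a 4))

    E-sampleF : ∀ v w → E (sampleF v) (λ b → 𝟙 b * chooses v w) ≡ link v w * p
    E-sampleF v w = begin
      E (sampleF v) (λ b → 𝟙 b * chooses v w)
        ≡⟨ E-guarded (V' v) _ (chooses v w) (λ Vv → E-bern-𝟙 _ _ (sampleF-bound v (subst T (sym Vv) _))) ⟩
      𝟙 (V' v) * (fromℕ (m ℕ.* D) * r * (𝟙 β * recip m))
        ≡⟨ solve 4 (λ V x r c → V :* (x :* r :* c) := V :* (r :* (x :* c))) refl (𝟙 (V' v)) (fromℕ (m ℕ.* D)) r (𝟙 β * recip m) ⟩
      𝟙 (V' v) * (r * (fromℕ (m ℕ.* D) * (𝟙 β * recip m)))
        ≡⟨ cong (λ z → 𝟙 (V' v) * (r * z)) (fromℕ*-recip-cancel m D β nonempty) ⟩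
      𝟙 (V' v) * (r * (fromℕ D * 𝟙 β))
        ≡⟨ solve 4 (λ V r d h → V :* (r :* (d :* h)) := V :* h :* (d :* r)) refl (𝟙 (V' v)) r (fromℕ D) (𝟙 β) ⟩
      link v w * p ∎
      where
      open ≡-Reasoning
      open +-*-Solver
      m : ℕ
      m = length (heavyNbrs v)
      r : ℚ
      r = recip (4 ℕ.* a)
      β : Bool
      β = H w ∧ adj G v w
      nonempty : T β → m ≢ 0
      nonempty t with heavyNbrs v | ∈-filter⁺ (T? ∘ (λ u → H u ∧ adj G v u)) (∈-allFin w) t
      ... | _ ∷ _ | _ = λ ()

    E-F-single : ∀ v w → E distF (λ F → 𝟙 (F v) * chooses v w * ¼) ≡ link v w * p * ¼
    E-F-single v w = begin
      E distF (λ F → 𝟙 (F v) * chooses v w * ¼)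
        ≡⟨ E-cong distF (λ F → cong (_* ¼) (sym (*-identityʳ (𝟙 (F v) * chooses v w)))) ⟩
      E distF (λ F → 𝟙 (F v) * chooses v w * 1ℚ * ¼)
        ≡⟨ E-*ʳ distF ¼ _ ⟩
      E distF (λ F → 𝟙 (F v) * chooses v w * 1ℚ) * ¼
        ≡⟨ cong (_* ¼) (E-forEach-factors sampleF _ ((v , λ b → 𝟙 b * chooses v w) ∷ []) ([] ∷ []) sampleF-isDist) ⟩
      E (sampleF v) (λ b → 𝟙 b * chooses v w) * 1ℚ * ¼
        ≡⟨ cong (λ z → z * 1ℚ * ¼) (E-sampleF v w) ⟩
      link v w * p * 1ℚ * ¼
        ≡⟨ cong (_* ¼) (*-identityʳ (link v w * p)) ⟩
      link v w * p * ¼ ∎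
      where open ≡-Reasoning

    E-F-pair : ∀ {u v} w → u ≢ v →
      E distF (λ F → (𝟙 (F u) * chooses u w) * (𝟙 (F v) * chooses v w) * ⅛) ≡ link u w * p * (link v w * p) * ⅛
    E-F-pair {u} {v} w u≢v = begin
      E distF (λ F → (𝟙 (F u) * chooses u w) * (𝟙 (F v) * chooses v w) * ⅛)
        ≡⟨ E-cong distF (λ F → cong (λ z → (𝟙 (F u) * chooses u w) * z * ⅛) (sym (*-identityʳ (𝟙 (F v) * chooses v w)))) ⟩
      E distF (λ F → (𝟙 (F u) * chooses u w) * ((𝟙 (F v) * chooses v w) * 1ℚ) * ⅛)
        ≡⟨ E-*ʳ distF ⅛ _ ⟩
      E distF (λ F → (𝟙 (F u) * chooses u w) * ((𝟙 (F v) * chooses v w) * 1ℚ)) * ⅛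
        ≡⟨ cong (_* ⅛) (E-forEach-factors sampleF _ ((u , λ b → 𝟙 b * chooses u w) ∷ (v , λ b → 𝟙 b * chooses v w) ∷ [])
                          ((u≢v ∷ []) ∷ [] ∷ []) sampleF-isDist) ⟩
      E (sampleF u) (λ b → 𝟙 b * chooses u w) * (E (sampleF v) (λ b → 𝟙 b * chooses v w) * 1ℚ) * ⅛
        ≡⟨ cong₂ (λ y z → y * (z * 1ℚ) * ⅛) (E-sampleF u w) (E-sampleF v w) ⟩
      link u w * p * (link v w * p * 1ℚ) * ⅛
        ≡⟨ cong (λ z → link u w * p * z * ⅛) (*-identityʳ (link v w * p)) ⟩
      link u w * p * (link v w * p) * ⅛ ∎
      where open ≡-Reasoning

    hit-single : ∀ {v w} → v ≢ w → H w ≡ true → E sample (λ o → 𝟙 (proposes o v w)) ≡ link v w * p * ¼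
    hit-single {v} {w} v≢w Hw = begin
      E sample (λ o → 𝟙 (proposes o v w))
        ≡⟨ E-sample _ ⟩
      E distF (λ F → E (distStar F) (λ st → E (distRed F) (λ red → 𝟙 (proposes (F , st , red) v w))))
        ≡⟨ E-cong distF (λ F → trans (E-cong (distStar F) (λ st → E-red-single F st v≢w Hw)) (E-star-single F v≢w)) ⟩
      E distF (λ F → 𝟙 (F v) * chooses v w * ¼)
        ≡⟨ E-F-single v w ⟩
      link v w * p * ¼ ∎
      where open ≡-Reasoning

    hit-pair : ∀ {u v w} → u ≢ v → u ≢ w → v ≢ w → H w ≡ true →
      E sample (λ o → 𝟙 (proposes o u w) * 𝟙 (proposes o v w)) ≡ link u w * p * (link v w * p) * ⅛
    hit-pair {u} {v} {w} u≢v u≢w v≢w Hw = begin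
      E sample (λ o → 𝟙 (proposes o u w) * 𝟙 (proposes o v w))
        ≡⟨ E-sample _ ⟩
      E distF (λ F → E (distStar F) (λ st → E (distRed F) (λ red → 𝟙 (proposes (F , st , red) u w) * 𝟙 (proposes (F , st , red) v w))))
        ≡⟨ E-cong distF (λ F → trans (E-cong (distStar F) (λ st → E-red-pair F st u≢v u≢w v≢w Hw)) (E-star-pair F u≢v u≢w v≢w)) ⟩
      E distF (λ F → (𝟙 (F u) * chooses u w) * (𝟙 (F v) * chooses v w) * ⅛)
        ≡⟨ E-F-pair w u≢v ⟩
      link u w * p * (link v w * p) * ⅛ ∎
      where open ≡-Reasoning

    hit : ∀ {w} → H w ≡ true → ∀ v → E sample (λ o → 𝟙 (proposes o v w)) ≡ link v w * p * ¼
    hit {w} Hw v with v ≟F w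
    ... | no v≢w = hit-single v≢w Hw
    ... | yes refl = trans (E-cong sample (λ o → cong 𝟙 (proposes-self o v))) (trans (E-const sample-isDist 0ℚ)
                       (sym (trans (cong (λ z → z * p * ¼) (link-self v)) (trans (cong (_* ¼) (*-zeroˡ p)) (*-zeroˡ ¼)))))

    hit-pair′ : ∀ {w} → H w ≡ true → ∀ {u v} → u ≢ v →
      E sample (λ o → 𝟙 (proposes o u w) * 𝟙 (proposes o v w)) ≡ link u w * p * (link v w * p) * ⅛
    hit-pair′ {w} Hw {u} {v} u≢v with u ≟F w | v ≟F w
    ... | no u≢w | no v≢w = hit-pair u≢v u≢w v≢w Hw
    ... | yes refl | _ =
      trans (E-cong sample (λ o → trans (cong (λ b → 𝟙 b * 𝟙 (proposes o v u)) (proposes-self o u)) (*-zeroˡ (𝟙 (proposes o v u)))))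
        (trans (E-const sample-isDist 0ℚ) (sym (trans (cong (λ z → z * p * (link v u * p) * ⅛) (link-self u))
          (solve 3 (λ p x e → con 0ℚ :* p :* x :* e := con 0ℚ) refl p (link v u * p) ⅛))))
      where open +-*-Solver
    ... | no _ | yes refl =
      trans (E-cong sample (λ o → trans (cong (λ b → 𝟙 (proposes o u v) * 𝟙 b) (proposes-self o v)) (*-zeroʳ (𝟙 (proposes o u v)))))
        (trans (E-const sample-isDist 0ℚ) (sym (trans (cong (λ z → link u v * p * (z * p) * ⅛) (link-self v))
          (solve 3 (λ x p e → x :* (con 0ℚ :* p) :* e := con 0ℚ) refl (link u v * p) p ⅛))))
      where open +-*-Solver

    hit² : ∀ {w} → H w ≡ true → ∀ u v →
      E sample (λ o → 𝟙 (proposes o u w) * 𝟙 (proposes o v w))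
        ≤ δ u v * E sample (λ o → 𝟙 (proposes o u w)) + link u w * p * (link v w * p) * ⅛
    hit² {w} Hw u v with v ≟F u
    ... | yes refl = ≤-by-gap pair
          (cong (_+ pair) (trans (*-identityˡ _) (E-cong sample (λ o → sym (𝟙-idem (proposes o u w))))))
          (*-nonNeg (*-nonNeg lp lp) (nonNegative⁻¹ ⅛))
      where
      pair : ℚ
      pair = link u w * p * (link u w * p) * ⅛
      lp : 0ℚ ≤ link u w * p
      lp = *-nonNeg (link-nonNeg u w) (*-nonNeg (fromℕ-nonNeg D) (recip-nonNeg (4 ℕ.* a)))
    ... | no v≢u = ≤-reflexive (trans (hit-pair′ Hw (v≢u ∘ sym))
                     (sym (trans (cong (_+ pair) (*-zeroˡ (E sample (λ o → 𝟙 (proposes o u w))))) (+-identityˡ pair))))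
      where
      pair : ℚ
      pair = link u w * p * (link v w * p) * ⅛

    E-proposals : ∀ {w} → H w ≡ true → E sample (λ o → proposals o w) ≡ linkDeg w * p * ¼
    E-proposals {w} Hw = begin
      E sample (λ o → proposals o w)
        ≡⟨ E-∑ sample (allFin n) (λ v o → 𝟙 (proposes o v w)) ⟩
      ∑ (allFin n) (λ v → E sample (λ o → 𝟙 (proposes o v w)))
        ≡⟨ ∑-cong (allFin n) (hit Hw) ⟩
      ∑ (allFin n) (λ v → link v w * p * ¼)
        ≡⟨ trans (∑-*ʳ (allFin n) ¼ (λ v → link v w * p)) (cong (_* ¼) (∑-*ʳ (allFin n) p (λ v → link v w))) ⟩
      linkDeg w * p * ¼ ∎
      where open ≡-Reasoning

    E-proposals² : ∀ {w} → H w ≡ true →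
      E sample (λ o → proposals o w * proposals o w) ≤ linkDeg w * p * ¼ + linkDeg w * p * (linkDeg w * p) * ⅛
    E-proposals² {w} Hw = begin
      E sample (λ o → proposals o w * proposals o w)
        ≡⟨ E-cong sample (λ o → ∑-*-∑ (allFin n) (I o) (I o)) ⟩
      E sample (λ o → ∑ (allFin n) (λ u → ∑ (allFin n) (λ v → I o u * I o v)))
        ≡⟨ trans (E-∑ sample (allFin n) (λ u o → ∑ (allFin n) (λ v → I o u * I o v)))
                 (∑-cong (allFin n) (λ u → E-∑ sample (allFin n) (λ v o → I o u * I o v))) ⟩
      ∑ (allFin n) (λ u → ∑ (allFin n) (λ v → E sample (λ o → I o u * I o v)))
        ≤⟨ ∑-mono-≤ (allFin n) (λ u → ∑-mono-≤ (allFin n) (hit² Hw u)) ⟩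
      ∑ (allFin n) (λ u → ∑ (allFin n) (λ v → δ u v * e u + l u * (l v) * ⅛))
        ≡⟨ ∑-cong (allFin n) inner ⟩
      ∑ (allFin n) (λ u → e u + l u * (linkDeg w * p) * ⅛)
        ≡⟨ ∑-+ (allFin n) e (λ u → l u * (linkDeg w * p) * ⅛) ⟩
      ∑ (allFin n) e + ∑ (allFin n) (λ u → l u * (linkDeg w * p) * ⅛)
        ≡⟨ cong₂ _+_ (trans (sym (E-∑ sample (allFin n) (λ v o → I o v))) (E-proposals Hw)) outer ⟩
      linkDeg w * p * ¼ + linkDeg w * p * (linkDeg w * p) * ⅛ ∎
      where
      open ≤-Reasoning
      I : Outcome → Fin n → ℚ
      I o v = 𝟙 (proposes o v w)
      e : Fin n → ℚ
      e u = E sample (λ o → I o u)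
      l : Fin n → ℚ
      l v = link v w * p
      ∑l : ∑ (allFin n) l ≡ linkDeg w * p
      ∑l = ∑-*ʳ (allFin n) p (λ v → link v w)
      inner : ∀ u → ∑ (allFin n) (λ v → δ u v * e u + l u * l v * ⅛) ≡ e u + l u * (linkDeg w * p) * ⅛
      inner u = trans (∑-+ (allFin n) (λ v → δ u v * e u) (λ v → l u * l v * ⅛))
        (cong₂ _+_ (∑-δ (λ _ → e u) (allFin⁺ n) (∈-allFin u))
          (trans (∑-*ʳ (allFin n) ⅛ (λ v → l u * l v)) (cong (_* ⅛) (trans (∑-*ˡ (allFin n) (l u) l) (cong (l u *_) ∑l)))))
      outer : ∑ (allFin n) (λ u → l u * (linkDeg w * p) * ⅛) ≡ linkDeg w * p * (linkDeg w * p) * ⅛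
      outer = trans (∑-*ʳ (allFin n) ⅛ (λ u → l u * (linkDeg w * p)))
                (cong (_* ⅛) (trans (∑-*ʳ (allFin n) (linkDeg w * p) l) (cong (_* (linkDeg w * p)) ∑l)))

    a/4a : fromℕ a * recip (4 ℕ.* a) ≡ ¼
    a/4a = begin
      fromℕ a * recip (4 ℕ.* a)                ≡⟨ solve 2 (λ x r → x :* r := con ¼ :* (con (fromℕ 4) :* x :* r)) refl (fromℕ a) (recip (4 ℕ.* a)) ⟩
      ¼ * (fromℕ 4 * fromℕ a * recip (4 ℕ.* a)) ≡⟨ cong (λ z → ¼ * (z * recip (4 ℕ.* a))) (sym (fromℕ-* 4 a)) ⟩
      ¼ * (fromℕ (4 ℕ.* a) * recip (4 ℕ.* a))
        ≡⟨ cong (¼ *_) (fromℕ*recip (ℕ.≢-nonZero⁻¹ (4 ℕ.* a) {{ℕ.m*n≢0 4 a {{_}} {{ℕ.>-nonZero 1≤a}}}})) ⟩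
      ¼ * 1ℚ                                   ≡⟨ *-identityʳ ¼ ⟩
      ¼ ∎
      where
      open ≡-Reasoning
      open +-*-Solver

    linkDeg*p : ∀ {w} → H w ≡ true → linkDeg w * p ≡ fromℕ (degIn G V' w ℕ.* D) * recip (4 ℕ.* a)
    linkDeg*p {w} Hw = begin
      linkDeg w * p                               ≡⟨ cong (_* p) (linkDeg-heavy Hw) ⟩
      fromℕ (degIn G V' w) * (fromℕ D * recip (4 ℕ.* a)) ≡⟨ sym (*-assoc (fromℕ (degIn G V' w)) (fromℕ D) (recip (4 ℕ.* a))) ⟩
      fromℕ (degIn G V' w) * fromℕ D * recip (4 ℕ.* a)   ≡⟨ cong (_* recip (4 ℕ.* a)) (sym (fromℕ-* (degIn G V' w) D)) ⟩
      fromℕ (degIn G V' w ℕ.* D) * recip (4 ℕ.* a) ∎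
      where open ≡-Reasoning

    heavy-split : ∀ {w} → H w ≡ true → T (V' w) × a ℕ.≤ degIn G V' w ℕ.* (2 ℕ.* D)
    heavy-split {w} Hw = Product.map₂ (ℕ.≤ᵇ⇒≤ a _) (Equivalence.to T-∧ (Equivalence.from T-≡ Hw))

    linkDeg*p≤¼ : ∀ {w} → H w ≡ true → linkDeg w * p ≤ ¼
    linkDeg*p≤¼ {w} Hw = subst₂ _≤_ (sym (linkDeg*p Hw)) a/4a
      (*-monoʳ-≤-nonNeg (recip (4 ℕ.* a)) {{nonNegative (recip-nonNeg (4 ℕ.* a))}}
        (fromℕ-mono-≤ (bound w (proj₁ (heavy-split Hw)))))

    ¼≤2*linkDeg*p : ∀ {w} → H w ≡ true → ¼ ≤ linkDeg w * p + linkDeg w * p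
    ¼≤2*linkDeg*p {w} Hw = subst₂ _≤_ a/4a double
      (*-monoʳ-≤-nonNeg (recip (4 ℕ.* a)) {{nonNegative (recip-nonNeg (4 ℕ.* a))}}
        (fromℕ-mono-≤ (proj₂ (heavy-split Hw))))
      where
      open +-*-Solver
      double : fromℕ (degIn G V' w ℕ.* (2 ℕ.* D)) * recip (4 ℕ.* a) ≡ linkDeg w * p + linkDeg w * p
      double = trans (cong (_* recip (4 ℕ.* a)) (trans (fromℕ-* (degIn G V' w) (2 ℕ.* D)) (cong (fromℕ (degIn G V' w) *_) (fromℕ-* 2 D))))
        (trans (solve 3 (λ x d r → x :* (con (fromℕ 2) :* d) :* r := x :* d :* r :+ x :* d :* r) refl (fromℕ (degIn G V' w)) (fromℕ D) (recip (4 ℕ.* a)))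
          (cong₂ _+_ (trans (cong (_* recip (4 ℕ.* a)) (sym (fromℕ-* (degIn G V' w) D))) (sym (linkDeg*p Hw)))
                     (trans (cong (_* recip (4 ℕ.* a)) (sym (fromℕ-* (degIn G V' w) D))) (sym (linkDeg*p Hw)))))

    E-bonferroni-heavy : ∀ {w} → H w ≡ true → κ ≤ E sample (λ o → bonferroni o w)
    E-bonferroni-heavy {w} Hw = begin
      κ
        ≤⟨ second-moment y (*-nonNeg (linkDeg-nonNeg w) (*-nonNeg (fromℕ-nonNeg D) (recip-nonNeg (4 ℕ.* a))))
             (¼≤2*linkDeg*p Hw) (linkDeg*p≤¼ Hw) ⟩
      y * ¼ + - (½ * (y * ¼ + y * y * ⅛))
        ≤⟨ +-monoʳ-≤ (y * ¼) (neg-antimono-≤ (*-monoˡ-≤ ½ (nonNegative⁻¹ ½) (E-proposals² Hw))) ⟩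
      y * ¼ + - (½ * E sample (λ o → proposals o w * proposals o w))
        ≡⟨ cong₂ (λ x z → x + - z) (sym (E-proposals Hw)) (sym (E-*ˡ sample ½ _)) ⟩
      E sample (λ o → proposals o w) + - E sample (λ o → ½ * (proposals o w * proposals o w))
        ≡⟨ cong (E sample (λ o → proposals o w) +_) (sym (E-neg sample _)) ⟩
      E sample (λ o → proposals o w) + E sample (λ o → - (½ * (proposals o w * proposals o w)))
        ≡⟨ sym (E-+ sample _ _) ⟩
      E sample (λ o → bonferroni o w) ∎
      where
      open ≤-Reasoning
      y : ℚ
      y = linkDeg w * p

    E-bonferroni : ∀ w → 𝟙 (H w) * κ ≤ E sample (λ o → bonferroni o w)
    E-bonferroni w = by-cases (H w) refl
      where
      by-cases : ∀ b → H w ≡ b → 𝟙 b * κ ≤ E sample (λ o → bonferroni o w)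
      by-cases true Hw = subst (_≤ E sample (λ o → bonferroni o w)) (sym (*-identityˡ κ)) (E-bonferroni-heavy Hw)
      by-cases false Hw = ≤-reflexive (trans (*-zeroˡ κ) (sym (trans (E-cong sample silent) (E-const sample-isDist 0ℚ))))
        where
        silent : ∀ o → bonferroni o w ≡ 0ℚ
        silent o = cong (λ k → k + - (½ * (k * k)))
          (trans (∑-cong (allFin n) (λ v → cong 𝟙 (proposes-light o v Hw))) (∑-0 (allFin n)))

-- The potential

c : ℚ
c = ℤ.+ 1 / 128

size removed : VSet n → ℚ
size X = ∑ (allFin _) (𝟙 ∘ X)
removed X = ∑ (allFin _) (λ t → 𝟙 (not (X t)))

Φ : State n → ℚ
Φ (X , M) = fromℕ (length M) + - (c * removed X)

𝟙-removed : ∀ v h f → 𝟙 (not (v ∧ not (h ∨ f))) ≤ 𝟙 (not v) + 𝟙 h + 𝟙 f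
𝟙-removed true true f = ≤-by-gap (𝟙 f) refl (𝟙-nonNeg f)
𝟙-removed true false true = ≤-reflexive refl
𝟙-removed true false false = ≤-refl
𝟙-removed false h f = ≤-by-gap (𝟙 h + 𝟙 f) (+-assoc 1ℚ (𝟙 h) (𝟙 f)) (+-nonNeg (𝟙-nonNeg h) (𝟙-nonNeg f))

module Potential {n : ℕ} (G : Graph n) (a b : ℕ) (ch : Chooser n) (V' : VSet n) (D : ℕ) where
  open Round G a b ch V' D

  removed-remaining : ∀ F → removed (remaining F) ≤ removed V' + size H + size F
  removed-remaining F = subst (removed (remaining F) ≤_)
    (trans (∑-+ (allFin n) _ (𝟙 ∘ F)) (cong (_+ size F) (∑-+ (allFin n) _ (𝟙 ∘ H))))
    (∑-mono-≤ (allFin n) (λ t → 𝟙-removed (V' t) (H t) (F t)))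

  E-sample-F : ∀ k → E sample (λ o → k (proj₁ o)) ≡ E distF k
  E-sample-F k = trans (E-sample _) (E-cong distF (λ F →
    trans (E-cong (distStar F) (λ st → E-const (forEach-isDist (allFin n) _ (sampleRed-isDist F)) (k F)))
          (E-const (forEach-isDist (allFin n) _ (sampleStar-isDist F)) (k F))))

  Φ-after-round : ∀ M o →
    Φ (V' , M) + ∑ (allFin n) (bonferroni o) + - (c * size H) + - (c * size (proj₁ o)) ≤ Φ (remaining (proj₁ o) , M ++ matched o)
  Φ-after-round M o = subst₂ _≤_ regroup
    (cong (_+ - (c * removed (remaining (proj₁ o)))) (sym (trans (cong fromℕ (length-++ M)) (fromℕ-+ (length M) _))))
    (+-mono-≤ (+-monoʳ-≤ (fromℕ (length M)) (matched-bonferroni o))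
              (neg-antimono-≤ (*-monoˡ-≤ c (/suc-nonNeg 1 127) (removed-remaining (proj₁ o)))))
    where
    open +-*-Solver
    regroup : fromℕ (length M) + ∑ (allFin n) (bonferroni o) + - (c * (removed V' + size H + size (proj₁ o)))
            ≡ Φ (V' , M) + ∑ (allFin n) (bonferroni o) + - (c * size H) + - (c * size (proj₁ o))
    regroup = solve 5 (λ m s r h f → m :+ s :+ :- (con c :* (r :+ h :+ f)) := m :+ :- (con c :* r) :+ s :+ :- (con c :* h) :+ :- (con c :* f)) refl
      (fromℕ (length M)) (∑ (allFin n) (bonferroni o)) (removed V') (size H) (size (proj₁ o))

  module _ (bound : DegreeBound G a V' D) (1≤a : 1 ℕ.≤ a) where
    open WithDegreeBound bound 1≤a

    linkDeg*p≤𝟙H*¼ : ∀ w → linkDeg w * p ≤ 𝟙 (H w) * ¼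
    linkDeg*p≤𝟙H*¼ w = by-cases (H w) refl
      where
      by-cases : ∀ b → H w ≡ b → linkDeg w * p ≤ 𝟙 b * ¼
      by-cases true Hw = subst (linkDeg w * p ≤_) (sym (*-identityˡ ¼)) (linkDeg*p≤¼ Hw)
      by-cases false Hw = ≤-reflexive (trans (cong (_* p) (linkDeg-light Hw)) (trans (*-zeroˡ p) (sym (*-zeroˡ ¼))))

    E-𝟙F : ∀ t → E distF (λ F → 𝟙 (F t)) ≡ ∑ (allFin n) (λ w → link t w * p)
    E-𝟙F t = begin
      E distF (λ F → 𝟙 (F t))
        ≡⟨ E-cong distF (λ F → sym (trans (*-identityʳ _) (*-identityʳ _))) ⟩
      E distF (λ F → 𝟙 (F t) * 1ℚ * 1ℚ)
        ≡⟨ E-forEach-factors sampleF _ ((t , λ b → 𝟙 b * 1ℚ) ∷ []) ([] ∷ []) sampleF-isDist ⟩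
      E (sampleF t) (λ b → 𝟙 b * 1ℚ) * 1ℚ
        ≡⟨ cong (_* 1ℚ) (E-guarded (V' t) _ 1ℚ (λ Vt → E-bern-𝟙 _ _ (sampleF-bound t (subst T (sym Vt) _)))) ⟩
      𝟙 (V' t) * (fromℕ (degIn G H t ℕ.* D) * r * 1ℚ) * 1ℚ
        ≡⟨ solve 3 (λ V x r → V :* (x :* r :* con 1ℚ) :* con 1ℚ := V :* (x :* r)) refl (𝟙 (V' t)) (fromℕ (degIn G H t ℕ.* D)) r ⟩
      𝟙 (V' t) * (fromℕ (degIn G H t ℕ.* D) * r)
        ≡⟨ cong (λ z → 𝟙 (V' t) * (z * r)) (fromℕ-* (degIn G H t) D) ⟩
      𝟙 (V' t) * (fromℕ (degIn G H t) * fromℕ D * r)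
        ≡⟨ cong (𝟙 (V' t) *_) (*-assoc (fromℕ (degIn G H t)) (fromℕ D) r) ⟩
      𝟙 (V' t) * (fromℕ (degIn G H t) * p)
        ≡⟨ cong (λ z → 𝟙 (V' t) * (z * p)) (length-filter (λ u → H u ∧ adj G t u) (allFin n)) ⟩
      𝟙 (V' t) * (∑ (allFin n) (λ w → 𝟙 (H w ∧ adj G t w)) * p)
        ≡⟨ cong (𝟙 (V' t) *_) (sym (∑-*ʳ (allFin n) p _)) ⟩
      𝟙 (V' t) * ∑ (allFin n) (λ w → 𝟙 (H w ∧ adj G t w) * p)
        ≡⟨ sym (∑-*ˡ (allFin n) (𝟙 (V' t)) _) ⟩
      ∑ (allFin n) (λ w → 𝟙 (V' t) * (𝟙 (H w ∧ adj G t w) * p))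
        ≡⟨ ∑-cong (allFin n) (λ w → sym (*-assoc (𝟙 (V' t)) _ p)) ⟩
      ∑ (allFin n) (λ w → link t w * p) ∎
      where
      open ≡-Reasoning
      open +-*-Solver
      r : ℚ
      r = recip (4 ℕ.* a)

    E-size-F : E distF size ≤ size H * ¼
    E-size-F = begin
      E distF size
        ≡⟨ E-∑ distF (allFin n) (λ t F → 𝟙 (F t)) ⟩
      ∑ (allFin n) (λ t → E distF (λ F → 𝟙 (F t)))
        ≡⟨ ∑-cong (allFin n) E-𝟙F ⟩
      ∑ (allFin n) (λ t → ∑ (allFin n) (λ w → link t w * p))
        ≡⟨ ∑-swap (allFin n) (allFin n) (λ t w → link t w * p) ⟩
      ∑ (allFin n) (λ w → ∑ (allFin n) (λ t → link t w * p))
        ≡⟨ ∑-cong (allFin n) (λ w → ∑-*ʳ (allFin n) p (λ t → link t w)) ⟩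
      ∑ (allFin n) (λ w → linkDeg w * p)
        ≤⟨ ∑-mono-≤ (allFin n) linkDeg*p≤𝟙H*¼ ⟩
      ∑ (allFin n) (λ w → 𝟙 (H w) * ¼)
        ≡⟨ ∑-*ʳ (allFin n) ¼ (𝟙 ∘ H) ⟩
      size H * ¼ ∎
      where open ≤-Reasoning

    round-potential : ∀ M → Φ (V' , M) ≤ E (round G a b ch D (V' , M)) Φ
    round-potential M = begin
      Φ₀
        ≤⟨ ≤-by-gap (size H * (ℤ.+ 1 / 256))
             (solve 2 (λ φ h → φ :+ h :* con κ :+ :- (con c :* h) :+ :- (con c :* (h :* con ¼)) := φ :+ h :* con (ℤ.+ 1 / 256)) refl Φ₀ (size H))
             (*-nonNeg (∑-nonNeg (allFin n) (𝟙-nonNeg ∘ H)) (/suc-nonNeg 1 255)) ⟩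
      Φ₀ + size H * κ + - (c * size H) + - (c * (size H * ¼))
        ≤⟨ +-mono-≤ (+-monoˡ-≤ (- (c * size H)) (+-monoʳ-≤ Φ₀ gain)) (neg-antimono-≤ (*-monoˡ-≤ c (/suc-nonNeg 1 127) E-size-F)) ⟩
      Φ₀ + ∑ (allFin n) (λ w → E sample (λ o → bonferroni o w)) + - (c * size H) + - (c * E distF size)
        ≡⟨ sym E-lower ⟩
      E sample lower
        ≤⟨ E-monoˢ sample-isDist (OnSupport-all sample (Φ-after-round M)) ⟩
      E sample (λ o → Φ (remaining (proj₁ o) , M ++ matched o))
        ≡⟨ sym (E-round M Φ) ⟩
      E (round G a b ch D (V' , M)) Φ ∎
      where
      open ≤-Reasoning
      open +-*-Solver
      Φ₀ : ℚ
      Φ₀ = Φ (V' , M)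
      lower : Outcome → ℚ
      lower o = Φ₀ + ∑ (allFin n) (bonferroni o) + - (c * size H) + - (c * size (proj₁ o))
      gain : size H * κ ≤ ∑ (allFin n) (λ w → E sample (λ o → bonferroni o w))
      gain = subst (_≤ ∑ (allFin n) (λ w → E sample (λ o → bonferroni o w))) (∑-*ʳ (allFin n) κ (𝟙 ∘ H)) (∑-mono-≤ (allFin n) E-bonferroni)
      E-lower : E sample lower
              ≡ Φ₀ + ∑ (allFin n) (λ w → E sample (λ o → bonferroni o w)) + - (c * size H) + - (c * E distF size)
      E-lower =
        trans (E-+ sample _ _) (cong₂ _+_
          (trans (E-+ sample _ _) (cong₂ _+_
            (trans (E-+ sample _ _) (cong₂ _+_ (E-const sample-isDist Φ₀) (E-∑ sample (allFin n) (λ w o → bonferroni o w))))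
            (E-const sample-isDist _)))
          (trans (E-neg sample _) (cong -_ (trans (E-*ˡ sample c _) (cong (c *_) (E-sample-F size))))))

-- Matchings

T-allᵇ : ∀ (P : A → Bool) xs → T (allᵇ P xs) ⇔ All (T ∘ P) xs
T-allᵇ P [] = mk⇔ (λ _ → []) (λ _ → _)
T-allᵇ P (x ∷ xs) = mk⇔
  (λ t → let px , rest = Equivalence.to T-∧ t in px ∷ Equivalence.to (T-allᵇ P xs) rest)
  (λ { (px ∷ rest) → Equivalence.from T-∧ (px , Equivalence.from (T-allᵇ P xs) rest) })

T-noDupᵇ : ∀ (xs : List (Fin n)) → T (noDupᵇ xs) ⇔ Unique xs
T-noDupᵇ [] = mk⇔ (λ _ → []) (λ _ → _)
T-noDupᵇ (x ∷ xs) = mk⇔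
  (λ t → let fresh , rest = Equivalence.to T-∧ t in
         All.map (≟-false⇒≢ _ _ ∘ Equivalence.to T-not-≡) (Equivalence.to (T-allᵇ _ xs) fresh) ∷ Equivalence.to (T-noDupᵇ xs) rest)
  (λ { (fresh ∷ rest) → Equivalence.from T-∧
          (Equivalence.from (T-allᵇ _ xs) (All.map ≢⇒T-not fresh) , Equivalence.from (T-noDupᵇ xs) rest) })
  where
  ≟-false⇒≢ : ∀ (x y : Fin n) → ⌊ x ≟F y ⌋ ≡ false → x ≢ y
  ≟-false⇒≢ x y eq x≡y with x ≟F y
  ≟-false⇒≢ x y () x≡y | yes _
  ... | no x≢y = x≢y x≡y
  ≢⇒T-not : ∀ {y} → x ≢ y → T (not ⌊ x ≟F y ⌋)
  ≢⇒T-not {y} x≢y with x ≟F y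
  ... | yes x≡y = x≢y x≡y
  ... | no _ = _

verts : List (Edge n) → List (Fin n)
verts = concatMap (λ e → proj₁ e ∷ proj₂ e ∷ [])

IsMatching : Graph n → List (Edge n) → Set
IsMatching G M = All (λ e → T (adj G (proj₁ e) (proj₂ e))) M × Unique (verts M)

T-isMatchingᵇ : ∀ (G : Graph n) M → T (isMatchingᵇ G M) ⇔ IsMatching G M
T-isMatchingᵇ G M = mk⇔
  (λ t → let es , vs = Equivalence.to T-∧ t in Equivalence.to (T-allᵇ _ M) es , Equivalence.to (T-noDupᵇ (verts M)) vs)
  (λ (es , vs) → Equivalence.from T-∧ (Equivalence.from (T-allᵇ _ M) es , Equivalence.from (T-noDupᵇ (verts M)) vs))

∈-verts⁻ : ∀ (es : List (Edge n)) {y} → y ∈ verts es → Σ (Edge n) λ e → e ∈ es × (y ≡ proj₁ e ⊎ y ≡ proj₂ e)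
∈-verts⁻ (e ∷ es) (here y≡) = e , here refl , inj₁ y≡
∈-verts⁻ (e ∷ es) (there (here y≡)) = e , here refl , inj₂ y≡
∈-verts⁻ (e ∷ es) (there (there y∈)) with ∈-verts⁻ es y∈
... | e′ , e′∈ , ends = e′ , there e′∈ , ends

∈-verts⁺ : ∀ {es : List (Edge n)} {e y} → e ∈ es → y ≡ proj₁ e ⊎ y ≡ proj₂ e → y ∈ verts es
∈-verts⁺ (here refl) (inj₁ refl) = here refl
∈-verts⁺ (here refl) (inj₂ refl) = there (here refl)
∈-verts⁺ (there e∈) ends = there (there (∈-verts⁺ e∈ ends))

IsMatching-++ : ∀ {G : Graph n} {M M′} → IsMatching G M → IsMatching G M′ →
  (∀ {u} → u ∈ verts M → u ∉ verts M′) → IsMatching G (M ++ M′)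
IsMatching-++ {M = M} {M′} (es , vs) (es′ , vs′) disjoint =
  All.++⁺ es es′ , subst Unique (sym (concatMap-++ _ M M′)) (Unique.++⁺ vs vs′ (λ (u∈ , u∈′) → disjoint u∈ u∈′))

count-unique : ∀ {xs : List (Fin n)} (P : Fin n → Bool) → Unique xs → All (T ∘ P) xs →
  fromℕ (length xs) ≤ ∑ (allFin n) (𝟙 ∘ P)
count-unique {n = n} {[]} P [] [] = ∑-nonNeg (allFin n) (𝟙-nonNeg ∘ P)
count-unique {n = n} {x ∷ xs} P (x∉ ∷ uniq) (Px ∷ Pxs) = begin
  fromℕ (length (x ∷ xs))                    ≡⟨ fromℕ-+ 1 (length xs) ⟩
  1ℚ + fromℕ (length xs)                     ≤⟨ +-monoʳ-≤ 1ℚ (count-unique P′ uniq (All.zipWith fresh (All.tabulate (λ y∈ → All.lookup x∉ y∈) , Pxs))) ⟩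
  1ℚ + ∑ (allFin n) (𝟙 ∘ P′)                 ≡⟨ cong (_+ ∑ (allFin n) (𝟙 ∘ P′)) (sym (trans (∑-δ (𝟙 ∘ P) (allFin⁺ n) (∈-allFin x)) (cong 𝟙 (Equivalence.to T-≡ Px)))) ⟩
  ∑ (allFin n) (λ t → δ x t * 𝟙 (P t)) + ∑ (allFin n) (𝟙 ∘ P′) ≡⟨ sym (∑-+ (allFin n) _ _) ⟩
  ∑ (allFin n) (λ t → δ x t * 𝟙 (P t) + 𝟙 (P′ t)) ≡⟨ ∑-cong (allFin n) split ⟩
  ∑ (allFin n) (𝟙 ∘ P) ∎
  where
  open ≤-Reasoning
  P′ : Fin n → Bool
  P′ t = P t ∧ not ⌊ t ≟F x ⌋
  fresh : ∀ {y} → x ≢ y × T (P y) → T (P′ y)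
  fresh {y} (x≢y , Py) with y ≟F x
  ... | yes y≡x = ⊥-elim (x≢y (sym y≡x))
  ... | no _ = Equivalence.from T-∧ (Py , _)
  split : ∀ t → δ x t * 𝟙 (P t) + 𝟙 (P′ t) ≡ 𝟙 (P t)
  split t with t ≟F x
  ... | yes refl = trans (cong (1ℚ * 𝟙 (P t) +_) (cong 𝟙 (∧-zeroʳ (P t)))) (trans (+-identityʳ _) (*-identityˡ _))
  ... | no _ = trans (cong₂ _+_ (*-zeroˡ (𝟙 (P t))) (cong 𝟙 (∧-identityʳ (P t)))) (+-identityˡ _)

Independent : Graph n → VSet n → Set
Independent G X = ∀ u v → T (X u) → T (X v) → T (adj G u v) → ⊥

-- Every edge of a matching has an endpoint outside an independent set X, and these endpoints are distinct.
matching≤removed : ∀ {G : Graph n} {M} X → IsMatching G M → Independent G X →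
  fromℕ (length M) ≤ removed X
matching≤removed {n = n} {G} {M} X (es , vs) independent =
  subst (_≤ removed X) (cong fromℕ (length-map outside M))
    (count-unique (not ∘ X) (outside-unique M vs) (All.map⁺ (All.map outside-free es)))
  where
  outside : Edge n → Fin n
  outside (x , y) = if X x then y else x
  outside-end : ∀ e → outside e ≡ proj₁ e ⊎ outside e ≡ proj₂ e
  outside-end (x , y) with X x
  ... | true = inj₂ refl
  ... | false = inj₁ refl
  outside-free : ∀ {e} → T (adj G (proj₁ e) (proj₂ e)) → T (not (X (outside e)))
  outside-free {x , y} xy with X x in Xx | X y in Xy
  ... | false | _ = subst (T ∘ not) (sym Xx) _
  ... | true | false = subst (T ∘ not) (sym Xy) _
  ... | true | true = ⊥-elim (independent x y (subst T (sym Xx) _) (subst T (sym Xy) _) xy)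
  outside-unique : ∀ es′ → Unique (verts es′) → Unique (map outside es′)
  outside-unique [] _ = []
  outside-unique ((x , y) ∷ es′) ((_ ∷ x∉) ∷ (y∉ ∷ uniq)) = All.tabulate fresh ∷ outside-unique es′ uniq
    where
    fresh : ∀ {z} → z ∈ map outside es′ → outside (x , y) ≢ z
    fresh z∈ o≡z with ∈-map⁻ outside z∈
    ... | e , e∈ , refl with outside-end (x , y)
    ... | inj₁ o≡x = All.lookup x∉ (∈-verts⁺ e∈ (outside-end e)) (trans (sym o≡x) o≡z)
    ... | inj₂ o≡y = All.lookup y∉ (∈-verts⁺ e∈ (outside-end e)) (trans (sym o≡y) o≡z)

-- Invariants of the loop

Consistent : Graph n → State n → Set
Consistent G (X , M) = IsMatching G M × (∀ {u} → u ∈ verts M → T (X u) → ⊥)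

degIn-pos : ∀ (G : Graph n) {X : VSet n} {u v} → T (X v) → T (adj G u v) → 1 ℕ.≤ degIn G X u
degIn-pos {n = n} G {X} {u} {v} Xv uv with filterᵇ (λ t → X t ∧ adj G u t) (allFin n)
                                          | ∈-filter⁺ (T? ∘ (λ t → X t ∧ adj G u t)) (∈-allFin v) (Equivalence.from T-∧ (Xv , uv))
... | _ ∷ _ | _ = ℕ.s≤s ℕ.z≤n

bound⇒independent : ∀ {G : Graph n} {a D X} → a ℕ.< D → DegreeBound G a X D → Independent G X
bound⇒independent {G = G} {a} {D} a<D bound u v Xu Xv uv = ℕ.<⇒≱ a<D (begin
  D                  ≡⟨ ℕ.*-identityˡ D ⟨
  1 ℕ.* D            ≤⟨ ℕ.*-monoˡ-≤ D (degIn-pos G Xv uv) ⟩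
  degIn G _ u ℕ.* D  ≤⟨ bound u Xu ⟩
  a                  ∎)
  where open ℕ.≤-Reasoning

colours-≢ : ∀ {red : VSet n} {p q} → red p ≡ true → red q ≡ false → p ≢ q
colours-≢ red-p blue-q refl with trans (sym red-p) blue-q
... | ()

red→blue-verts-unique : ∀ (red : VSet n) (st : Fin n → Fin n) es →
  All (λ e → red (proj₁ e) ≡ true × red (proj₂ e) ≡ false × st (proj₁ e) ≡ proj₂ e) es →
  Unique (map proj₂ es) → Unique (verts es)
red→blue-verts-unique red st [] [] [] = []
red→blue-verts-unique red st ((x , w) ∷ es) ((rx , bw , sx) ∷ ok) (w∉ ∷ heads) =
  (colours-≢ rx bw ∷ All.tabulate tail-fresh) ∷ All.tabulate head-fresh ∷ red→blue-verts-unique red st es ok heads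
  where
  tail-fresh : ∀ {y} → y ∈ verts es → x ≢ y
  tail-fresh y∈ x≡y with ∈-verts⁻ es y∈
  ... | e , e∈ , inj₁ y≡tail = let (_ , _ , se) = All.lookup ok e∈ in
        All.lookup w∉ (∈-map⁺ proj₂ e∈) (trans (sym sx) (trans (cong st (trans x≡y y≡tail)) se))
  ... | e , e∈ , inj₂ y≡head = colours-≢ rx (proj₁ (proj₂ (All.lookup ok e∈))) (trans x≡y y≡head)
  head-fresh : ∀ {y} → y ∈ verts es → w ≢ y
  head-fresh y∈ w≡y with ∈-verts⁻ es y∈
  ... | e , e∈ , inj₁ y≡tail = colours-≢ (proj₁ (All.lookup ok e∈)) bw (sym (trans w≡y y≡tail))
  ... | e , e∈ , inj₂ y≡head = All.lookup w∉ (∈-map⁺ proj₂ e∈) (trans w≡y y≡head)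

module _ {n : ℕ} (G : Graph n) (a b : ℕ) (ch : Chooser n) where

  ∈-pick : ∀ w L {e} → e ∈ pick G a b ch w L → proj₁ e ∈ L × proj₂ e ≡ w
  ∈-pick w (x ∷ xs) (here refl) = ∈-lookup (ch w x xs) , refl

  picked-heads : ∀ (L : Fin n → List (Fin n)) ws → List (Fin n)
  picked-heads L ws = map proj₂ (concatMap (λ w → pick G a b ch w (L w)) ws)

  ∈-picked-heads : ∀ L ws {z} → z ∈ picked-heads L ws → z ∈ ws
  ∈-picked-heads L ws z∈ with e , e∈ , refl ← ∈-map⁻ proj₂ z∈ =
    Any.map (λ {w} e∈pick → proj₂ (∈-pick w (L w) e∈pick)) (∈-concatMap⁻ (λ w → pick G a b ch w (L w)) {xs = ws} e∈)

  picked-heads-unique : ∀ L {ws} → Unique ws → Unique (picked-heads L ws)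
  picked-heads-unique L [] = []
  picked-heads-unique L {w ∷ ws} (w∉ ∷ uniq) with L w
  ... | [] = picked-heads-unique L uniq
  ... | _ ∷ _ = All.tabulate (λ z∈ w≡z → All.lookup w∉ (∈-picked-heads L ws z∈) w≡z) ∷ picked-heads-unique L uniq

module RoundInvariants {n : ℕ} (G : Graph n) (a b : ℕ) (ch : Chooser n) (V' : VSet n) (D : ℕ) where
  open Round G a b ch V' D

  -- what the samplers guarantee about an outcome
  Admissible : Outcome → Set
  Admissible (F , st , red) = (∀ v → T (F v) → T (V' v)) × (∀ v → st v ≡ v ⊎ T (adj G v (st v)))

  round-onSupport : ∀ {P : State n → Set} M → (∀ o → Admissible o → P (remaining (proj₁ o) , M ++ matched o)) →
    OnSupport (round G a b ch D (V' , M)) P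
  round-onSupport M k =
    OnSupport->>= distF _ (OnSupport-map F-sane λ {F} F⊆V' →
    OnSupport->>= (matchHeavy G a b ch H F) (λ M~ → return (remaining F , M ++ M~)) (
    OnSupport->>= (distStar F) (λ st → distRed F >>= λ red → return (matched (F , st , red))) (OnSupport-map (star-sane F) λ {st} st-ok →
    OnSupport->>= (distRed F) (λ red → return (matched (F , st , red))) (OnSupport-all (distRed F) λ red →
      (k (F , st , red) (F⊆V' , st-ok) ∷ []) ∷ []))))
    where
    F-support : ∀ v → OnSupport (sampleF v) (λ b → T b → T (V' v))
    F-support v with V' v
    ... | true = OnSupport-all (bern (degIn G H v ℕ.* D) (4 ℕ.* a)) (λ _ _ → _)
    ... | false = (λ ()) ∷ []
    F-sane : OnSupport distF (λ F → ∀ v → T (F v) → T (V' v))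
    F-sane = forEach-onSupport (allFin n) _ (λ v b → T b → T (V' v)) (λ _ ()) F-support
    star-support : ∀ F v → OnSupport (sampleStar F v) (λ y → y ≡ v ⊎ T (adj G v y))
    star-support F v with F v
    ... | true = uniform-onSupport v (heavyNbrs v) (inj₁ refl)
                   (All.tabulate (λ y∈ → inj₂ (proj₂ (Equivalence.to T-∧
                      (proj₂ (∈-filter⁻ (T? ∘ (λ u → H u ∧ adj G v u)) {xs = allFin n} y∈))))))
    ... | false = inj₁ refl ∷ []
    star-sane : ∀ F → OnSupport (distStar F) (λ st → ∀ v → st v ≡ v ⊎ T (adj G v (st v)))
    star-sane F = forEach-onSupport (allFin n) _ (λ v y → y ≡ v ⊎ T (adj G v y)) (λ _ → inj₁ refl) (star-support F)

  proposes⇒ : ∀ F st red {v w} → T (proposes (F , st , red) v w) →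
    T (F v) × red v ≡ true × T (H w) × red w ≡ false × st v ≡ w
  proposes⇒ F st red {v} {w} t with F v | red v | H w | red w | st v ≟F w
  ... | true | true | true | false | yes sv≡w = _ , refl , _ , refl , sv≡w

  ∈-matched : ∀ o {e} → e ∈ matched o → T (proposes o (proj₁ e) (proj₂ e))
  ∈-matched o e∈
    with Any.satisfied (∈-concatMap⁻ (λ w → pick G a b ch w (filterᵇ (λ v → proposes o v w) (allFin n))) {xs = allFin n} e∈)
  ... | w , e∈pick with ∈-pick G a b ch w _ e∈pick
  ... | x∈ , refl = proj₂ (∈-filter⁻ (T? ∘ (λ v → proposes o v w)) {xs = allFin n} x∈)

  matched-matching : ∀ o → Admissible o → IsMatching G (matched o)
  matched-matching o@(F , st , red) (_ , st-ok) =
    All.tabulate (λ e∈ → adjacent (∈-matched o e∈)) ,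
    red→blue-verts-unique red st (matched o)
      (All.tabulate (λ e∈ → let (_ , rx , _ , bw , sx) = proposes⇒ F st red (∈-matched o e∈) in rx , bw , sx))
      (picked-heads-unique G a b ch (λ w → filterᵇ (λ v → proposes o v w) (allFin n)) (allFin⁺ n))
    where
    adjacent : ∀ {x w} → T (proposes o x w) → T (adj G x w)
    adjacent {x} t with proposes⇒ F st red t | st-ok x
    ... | _ , rx , _ , bw , sx | inj₂ x~sx = subst (T ∘ adj G x) sx x~sx
    ... | _ , rx , _ , bw , sx | inj₁ sx≡x = ⊥-elim (colours-≢ rx bw (trans (sym sx≡x) sx))

  matched-leave : ∀ o → Admissible o → ∀ {u} → u ∈ verts (matched o) → T (V' u) × remaining (proj₁ o) u ≡ false
  matched-leave o@(F , st , red) (F⊆V' , _) u∈ with ∈-verts⁻ (matched o) u∈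
  ... | (x , w) , e∈ , inj₁ refl = F⊆V' x Fx , left-via-F
    where
    Fx : T (F x)
    Fx = proj₁ (proposes⇒ F st red (∈-matched o e∈))
    left-via-F : V' x ∧ not (H x ∨ F x) ≡ false
    left-via-F rewrite Equivalence.to T-≡ Fx | ∨-zeroʳ (H x) = ∧-zeroʳ (V' x)
  ... | (x , w) , e∈ , inj₂ refl = proj₁ (Equivalence.to T-∧ Hw) , left-via-H
    where
    Hw : T (H w)
    Hw = proj₁ (proj₂ (proj₂ (proposes⇒ F st red (∈-matched o e∈))))
    left-via-H : V' w ∧ not (H w ∨ F w) ≡ false
    left-via-H rewrite Equivalence.to T-≡ Hw = ∧-zeroʳ (V' w)

  round-consistent : ∀ {M} o → Consistent G (V' , M) → Admissible o → Consistent G (remaining (proj₁ o) , M ++ matched o)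
  round-consistent {M} o (M-matching , M-left) adm =
    IsMatching-++ {G = G} M-matching (matched-matching o adm) (λ u∈M u∈new → M-left u∈M (proj₁ (matched-leave o adm u∈new))) ,
    λ {u} u∈ u-stays → [ (λ u∈M → M-left u∈M (proj₁ (Equivalence.to T-∧ u-stays)))
                   , (λ u∈new → subst T (proj₂ (matched-leave o adm u∈new)) u-stays)
                   ]′ (∈-++⁻ (verts M) (subst (u ∈_) (concatMap-++ (λ e → proj₁ e ∷ proj₂ e ∷ []) M (matched o)) u∈))

  round-bound : ∀ F → DegreeBound G a (remaining F) (2 ℕ.* D)
  round-bound F v stays = ℕ.≤-trans (ℕ.*-monoˡ-≤ (2 ℕ.* D) (degIn-mono G v (λ u → proj₁ ∘ Equivalence.to T-∧)))
                                    (ℕ.<⇒≤ (ℕ.≰⇒> not-heavy))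
    where
    not-heavy : ¬ (a ℕ.≤ degIn G V' v ℕ.* (2 ℕ.* D))
    not-heavy a≤ = let V'v , light = Equivalence.to T-∧ stays in
      subst T (∨-conicalˡ (H v) (F v) (Equivalence.to T-not-≡ light)) (Equivalence.from T-∧ (V'v , ℕ.≤⇒≤ᵇ a≤))

n<2^n : ∀ n → n ℕ.< 2 ^ n
n<2^n zero = ℕ.s≤s ℕ.z≤n
n<2^n (suc n) = ℕ.+-mono-≤ (ℕ.m^n>0 2 n) (ℕ.≤-trans (n<2^n n) (ℕ.m≤m+n (2 ^ n) 0))

module Loop {n : ℕ} (G : Graph n) (a b : ℕ) (ch : Chooser n) where

  round-isDist : ∀ D s → IsDistribution (round G a b ch D s)
  round-isDist D (V' , M) =
    >>=-isDist (forEach-isDist (allFin n) _ sampleF-isDist) λ F →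
    >>=-isDist (>>=-isDist (forEach-isDist (allFin n) _ (sampleStar-isDist F)) λ st →
                >>=-isDist (forEach-isDist (allFin n) _ (sampleRed-isDist F)) λ red → return-isDist _) λ M~ →
    return-isDist _
    where open Round G a b ch V' D

  loop-isDist : ∀ k i s → IsDistribution (loop G a b ch k i s)
  loop-isDist zero i s = return-isDist s
  loop-isDist (suc k) i s with b ℕ.* 2 ^ i ≤ᵇ a
  ... | true = >>=-isDist (round-isDist (b ℕ.* 2 ^ i) s) (loop-isDist k (suc i))
  ... | false = return-isDist s

  double-D : ∀ i → b ℕ.* 2 ^ suc i ≡ 2 ℕ.* (b ℕ.* 2 ^ i)
  double-D i = trans (sym (ℕ.*-assoc b 2 (2 ^ i))) (trans (cong (ℕ._* 2 ^ i) (ℕ.*-comm b 2)) (ℕ.*-assoc 2 b (2 ^ i)))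

  Invariant : ℕ → State n → Set
  Invariant i (X , M) = DegreeBound G a X (b ℕ.* 2 ^ i) × Consistent G (X , M)

  Finished : State n → Set
  Finished s = Consistent G s × Independent G (proj₁ s)

  halt : ∀ s {D} → a ℕ.< D → DegreeBound G a (proj₁ s) D → Consistent G s →
    (Φ s ≤ E (return s) Φ) × OnSupport (return s) Finished
  halt s a<D bound cons = ≤-reflexive (sym (E-return s Φ)) , (cons , bound⇒independent {G = G} a<D bound) ∷ []

  loop-analysis : ∀ k i s → k ℕ.+ i ≡ a → 1 ℕ.≤ b → Invariant i s →
    (Φ s ≤ E (loop G a b ch k i s) Φ) × OnSupport (loop G a b ch k i s) Finished
  loop-analysis zero i s refl 1≤b (bound , cons) =
    halt s (ℕ.<-≤-trans (n<2^n i) (ℕ.m≤n*m (2 ^ i) b {{ℕ.>-nonZero 1≤b}})) bound cons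
  loop-analysis (suc k) i s@(X , M) k+i≡a 1≤b (bound , cons) with b ℕ.* 2 ^ i ≤ᵇ a in D≤ᵇa
  ... | false = halt s (ℕ.≰⇒> (λ D≤a → subst T D≤ᵇa (ℕ.≤⇒≤ᵇ D≤a))) bound cons
  ... | true =
    ≤-trans (round-potential bound 1≤a M)
      (subst (E (round G a b ch D s) Φ ≤_) (sym (E->>= (round G a b ch D s) _ Φ))
        (E-monoˢ (round-isDist D s) (OnSupport-map next (proj₁ ∘ continue)))) ,
    OnSupport->>= (round G a b ch D s) _ (OnSupport-map next (proj₂ ∘ continue))
    where
    D : ℕ
    D = b ℕ.* 2 ^ i
    D≤a : D ℕ.≤ a
    D≤a = ℕ.≤ᵇ⇒≤ D a (subst T (sym D≤ᵇa) _)
    1≤a : 1 ℕ.≤ a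
    1≤a = ℕ.≤-trans (ℕ.*-mono-≤ 1≤b (ℕ.m^n>0 2 i)) D≤a
    open Potential G a b ch X D
    open RoundInvariants G a b ch X D
    open Round G a b ch X D using (remaining)
    next : OnSupport (round G a b ch D s) (Invariant (suc i))
    next = round-onSupport M λ o adm →
      subst (DegreeBound G a (remaining (proj₁ o))) (sym (double-D i)) (round-bound (proj₁ o)) , round-consistent o cons adm
    continue : ∀ {s′} → Invariant (suc i) s′ →
      (Φ s′ ≤ E (loop G a b ch k (suc i) s′) Φ) × OnSupport (loop G a b ch k (suc i) s′) Finished
    continue {s′} inv = loop-analysis k (suc i) s′ (trans (ℕ.+-suc k i) k+i≡a) 1≤b inv

-- The approximation guarantee

1/256 : ℚ
1/256 = ℤ.+ 1 / 256

-- Either M is a 256-approximation, or it is tiny.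
length≤ : ∀ L m → m ℕ.≤ L → fromℕ m ≤ fromℕ L * 𝟙 (L ≤ᵇ 256 ℕ.* m) + 1/256 * fromℕ L
length≤ L m m≤L with L ≤ᵇ 256 ℕ.* m in good
... | true = ≤-trans (fromℕ-mono-≤ m≤L)
    (≤-by-gap (1/256 * fromℕ L) (cong (_+ 1/256 * fromℕ L) (*-identityʳ (fromℕ L))) (*-nonNeg (/suc-nonNeg 1 255) (fromℕ-nonNeg L)))
... | false = begin
  fromℕ m                        ≡⟨ sym (trans (sym (*-assoc 1/256 (fromℕ 256) (fromℕ m))) (*-identityˡ (fromℕ m))) ⟩
  1/256 * (fromℕ 256 * fromℕ m)  ≡⟨ cong (1/256 *_) (sym (fromℕ-* 256 m)) ⟩
  1/256 * fromℕ (256 ℕ.* m)      ≤⟨ *-monoˡ-≤ 1/256 (/suc-nonNeg 1 255) (fromℕ-mono-≤ (ℕ.<⇒≤ (ℕ.≰⇒> (λ L≤ → subst T good (ℕ.≤⇒≤ᵇ {L} {256 ℕ.* m} L≤))))) ⟩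
  1/256 * fromℕ L                ≡⟨ sym (trans (cong (_+ 1/256 * fromℕ L) (*-zeroʳ (fromℕ L))) (+-identityˡ _)) ⟩
  fromℕ L * 0ℚ + 1/256 * fromℕ L ∎
  where open ≤-Reasoning

module Approximation {n : ℕ} (G : Graph n) (a b : ℕ) (1≤b : 1 ℕ.≤ b) (degree-bound : ∀ v → deg G v ℕ.* b ℕ.≤ a)
                     (ch : Chooser n) (OPT : List (Edge n)) (maximum : IsMaximumMatching G OPT) where
  open Loop G a b ch

  s₀ : State n
  s₀ = (λ _ → true) , []

  final : Dist (State n)
  final = loop G a b ch a 0 s₀

  L : ℕ
  L = length OPT

  Good : List (Edge n) → Bool
  Good M = isMatchingᵇ G M ∧ (L ≤ᵇ 256 ℕ.* length M)

  matching-of : ∀ {s} → Finished s → isMatchingᵇ G (proj₂ s) ≡ true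
  matching-of {s} ((M-matching , _) , _) = Equivalence.to T-≡ (Equivalence.from (T-isMatchingᵇ G (proj₂ s)) M-matching)

  size-M : State n → ℚ
  size-M s = fromℕ (length (proj₂ s))

  analysis : (Φ s₀ ≤ E final Φ) × OnSupport final Finished
  analysis = loop-analysis a 0 s₀ (ℕ.+-identityʳ a) 1≤b
    ((λ v _ → subst (λ D → deg G v ℕ.* D ℕ.≤ a) (sym (ℕ.*-identityʳ b)) (degree-bound v)) , ([] , []) , λ ())

  expected-size-lower : c * fromℕ L ≤ E final size-M
  expected-size-lower = begin
    c * fromℕ L                                    ≡⟨ sym (+-identityˡ _) ⟩
    0ℚ + c * fromℕ L                               ≤⟨ +-mono-≤ (subst (_≤ E final Φ) Φ₀≡0 (proj₁ analysis)) (*-monoˡ-≤ c (/suc-nonNeg 1 127) OPT≤removed) ⟩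
    E final Φ + c * E final (removed ∘ proj₁)      ≡⟨ cong (E final Φ +_) (sym (E-*ˡ final c _)) ⟩
    E final Φ + E final (λ s → c * removed (proj₁ s)) ≡⟨ sym (E-+ final Φ _) ⟩
    E final (λ s → Φ s + c * removed (proj₁ s))    ≡⟨ E-cong final (λ s → solve 3 (λ m c r → m :+ :- (c :* r) :+ c :* r := m) refl (size-M s) c (removed (proj₁ s))) ⟩
    E final size-M ∎
    where
    open ≤-Reasoning
    open +-*-Solver
    Φ₀≡0 : Φ s₀ ≡ 0ℚ
    Φ₀≡0 = cong (λ r → 0ℚ + - (c * r)) (∑-0 (allFin n))
    OPT≤removed : fromℕ L ≤ E final (removed ∘ proj₁)
    OPT≤removed = subst (_≤ E final (removed ∘ proj₁)) (E-const (loop-isDist a 0 s₀) (fromℕ L))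
      (E-monoˢ (loop-isDist a 0 s₀) (OnSupport-map (proj₂ analysis) λ {s} (_ , independent) →
        matching≤removed {G = G} (proj₁ s) (Equivalence.to (T-isMatchingᵇ G OPT) (proj₁ maximum)) independent))

  P-good : ℚ
  P-good = E final (𝟙 ∘ Good ∘ proj₂)

  expected-size-upper : E final size-M ≤ fromℕ L * P-good + 1/256 * fromℕ L
  expected-size-upper = begin
    E final size-M
      ≤⟨ E-monoˢ (loop-isDist a 0 s₀) (OnSupport-map (proj₂ analysis) λ {s} fin →
           subst (λ b → size-M s ≤ fromℕ L * 𝟙 (b ∧ _) + 1/256 * fromℕ L) (sym (matching-of fin))
                 (length≤ L (length (proj₂ s)) (proj₂ maximum (proj₂ s) (Equivalence.from T-≡ (matching-of fin))))) ⟩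
    E final (λ s → fromℕ L * 𝟙 (Good (proj₂ s)) + 1/256 * fromℕ L)
      ≡⟨ E-+ final _ _ ⟩
    E final (λ s → fromℕ L * 𝟙 (Good (proj₂ s))) + E final (λ _ → 1/256 * fromℕ L)
      ≡⟨ cong₂ _+_ (E-*ˡ final (fromℕ L) _) (E-const (loop-isDist a 0 s₀) _) ⟩
    fromℕ L * P-good + 1/256 * fromℕ L ∎
    where open ≤-Reasoning

  -- c = 2/256, so the two bounds leave 1/256 · L ≤ L · P-good.
  P-good-bound : 1/256 ≤ P-good
  P-good-bound = by-cases L refl
    where
    by-cases : ∀ l → L ≡ l → 1/256 ≤ P-good
    by-cases zero L≡0 = ≤-trans (toWitness {a? = 1/256 ≤? 1ℚ} _)
      (≤-reflexive (sym (trans (E-congˢ final always-good) (E-const (loop-isDist a 0 s₀) 1ℚ))))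
      where
      always-good : OnSupport final (λ s → 𝟙 (Good (proj₂ s)) ≡ 1ℚ)
      always-good = OnSupport-map (proj₂ analysis) λ {s} fin →
        cong 𝟙 (cong₂ _∧_ (matching-of fin) (cong (_≤ᵇ 256 ℕ.* length (proj₂ s)) L≡0))
    by-cases (suc l) L≡1+l = *-cancelˡ-≤-pos (fromℕ L) {{subst (Positive ∘ fromℕ) (sym L≡1+l) (normalize-pos (suc l) 1)}}
      (+-cancelʳ-≤ _ _ (1/256 * fromℕ L) (begin
        fromℕ L * 1/256 + 1/256 * fromℕ L ≡⟨ solve 1 (λ x → x :* con 1/256 :+ con 1/256 :* x := con c :* x) refl (fromℕ L) ⟩
        c * fromℕ L                        ≤⟨ expected-size-lower ⟩
        E final size-M                     ≤⟨ expected-size-upper ⟩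
        fromℕ L * P-good + 1/256 * fromℕ L ∎))
      where
      open ≤-Reasoning
      open +-*-Solver

  globalAlg-approx : 1/256 ≤ Pr (globalAlg G a b ch) Good
  globalAlg-approx = subst (1/256 ≤_) (sym Pr≡P-good) P-good-bound
    where
    Pr≡P-good : Pr (globalAlg G a b ch) Good ≡ P-good
    Pr≡P-good = trans (Pr≡E𝟙 (globalAlg G a b ch) Good)
      (trans (E->>= final (λ s → return (proj₂ s)) (𝟙 ∘ Good)) (E-cong final (λ s → E-return (proj₂ s) (𝟙 ∘ Good))))

corollary2 : Σ ℕ λ C → Σ ℚ λ p → (1 ℕ.≤ C) × (0ℚ < p) ×
    ((n : ℕ) (G : Graph n) (a b : ℕ) → 0 ℕ.< b → (∀ v → deg G v ℕ.* b ℕ.≤ a) →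
     (ch : Chooser n) (OPT : List (Edge n)) → IsMaximumMatching G OPT →
     p ≤ Pr (globalAlg G a b ch) (λ M → isMatchingᵇ G M ∧ (length OPT ≤ᵇ C ℕ.* length M)))
corollary2 = 256 , 1/256 , ℕ.s≤s ℕ.z≤n , positive⁻¹ 1/256 ,
  λ n G a b 0<b degree-bound ch OPT maximum → Approximation.globalAlg-approx G a b 0<b degree-bound ch OPT maximum
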